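{- There exist Gorenstein lattice polytopes whose $h^*$-polynomials are $\gamma$-positive but not log-concave, and there exist Gorenstein lattice polytopes whose $h^*$-polynomials are log-concave but not $\gamma$-positive.
   Context: For a lattice polytope $P\subseteq\mathbb{R}^n$ of dimension $d$, $E_P(m)=\#(mP\cap\mathbb{Z}^n)$ and $h^*_P(x)$ is the unique polynomial of degree at most $d$ with $\sum_{m\geq0}E_P(m)x^m=h^*_P(x)/(1-x)^{d+1}$. A lattice polytope is Gorenstein if some positive dilate is, up to lattice translation, reflexive (contains the origin in its interior and has a lattice polar dual); equivalently, $h^*_P$ is palindromic. A palindromic polynomial $p(x)$ of degree $s$ (i.e. $[x^j]p=[x^{s-j}]p$) can be written uniquely as $\sum_{j=0}^{\lfloor s/2\rfloor}\gamma_jx^j(1+x)^{s-2j}$; it is $\gamma$-positive if all $\gamma_j\geq0$. A polynomial $\sum_{j=0}^s a_jx^j$ of degree $s$ is log-concave if all $a_j>0$ and $a_j^2\geq a_{j-1}a_{j+1}$ for $1\leq j\leq s-1$. -}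

module Defs where

open import Data.Nat as ℕ using (ℕ; zero; suc)
open import Data.Nat.Combinatorics using (_C_)
open import Data.Integer as ℤ using (ℤ; +_)
open import Data.Rational as ℚ using (ℚ; 0ℚ; 1ℚ)
open import Data.Fin using (Fin; zero; suc)
open import Data.Vec using (Vec; lookup; map; zipWith)
open import Data.List using (List; []; _∷_; length)
open import Data.List.Membership.Propositional using (_∈_)
open import Data.List.Relation.Unary.Unique.Propositional using (Unique)
open import Data.Product using (Σ; _×_; ∃)
open import Relation.Binary.PropositionalEquality using (_≡_; _≢_)
open import Relation.Nullary using (¬_)

sumℚ : ∀ {k} → (Fin k → ℚ) → ℚ
sumℚ {zero}  f = 0ℚ
sumℚ {suc k} f = f zero ℚ.+ sumℚ (λ i → f (suc i))

sumℤ : ℕ → (ℕ → ℤ) → ℤ        -- sumℤ N f = f 0 + ... + f N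
sumℤ zero    f = f zero
sumℤ (suc N) f = sumℤ N f ℤ.+ f (suc N)

ℤtoℚ : ℤ → ℚ
ℤtoℚ z = z ℚ./ 1

ℕtoℚ : ℕ → ℚ
ℕtoℚ n = ℤtoℚ (+ n)

-- Lattice polytopes P = conv(v₀,…,v_k) ⊆ ℝⁿ with vᵢ ∈ ℤⁿ
-- (rational points suffice to describe membership of rational points)

record LatticePolytope (n : ℕ) : Set where
  field
    k     : ℕ
    verts : Fin (suc k) → Vec ℤ n
open LatticePolytope public

-- y ∈ m·P  (m a rational scalar ≥ 0), i.e. y = Σ λᵢ vᵢ, λᵢ ≥ 0, Σ λᵢ = m
InDilate : ∀ {n} → LatticePolytope n → ℚ → Vec ℚ n → Set
InDilate P m y =
  Σ (Fin (suc (k P)) → ℚ) λ lam →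
    (∀ i → 0ℚ ℚ.≤ lam i) ×
    (sumℚ lam ≡ m) ×
    (∀ c → sumℚ (λ i → lam i ℚ.* ℤtoℚ (lookup (verts P i) c)) ≡ lookup y c)

-- E_P(m) = e : the lattice points of mP are exactly those of a duplicate-free
-- list of length e
EhrhartCount : ∀ {n} → LatticePolytope n → ℕ → ℕ → Set
EhrhartCount {n} P m e =
  Σ (List (Vec ℤ n)) λ L →
    Unique L × (length L ≡ e) ×
    (∀ x → (x ∈ L → InDilate P (ℕtoℚ m) (map ℤtoℚ x)) ×
           (InDilate P (ℕtoℚ m) (map ℤtoℚ x) → x ∈ L))

AffIndep : ∀ {n r} → (Fin (suc r) → Vec ℤ n) → Set
AffIndep {n} {r} f =
  (c : Fin r → ℚ) →
  (∀ coord → sumℚ (λ i → c i ℚ.* ℤtoℚ (lookup (f (suc i)) coord ℤ.- lookup (f zero) coord)) ≡ 0ℚ) →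
  ∀ i → c i ≡ 0ℚ

-- dim P = d : the affine hull of the vertices (= that of P) has dimension d
Dim : ∀ {n} → LatticePolytope n → ℕ → Set
Dim P d =
  (Σ (Fin (suc d) → Fin (suc (k P))) λ idx → AffIndep (λ i → verts P (idx i))) ×
  ((idx : Fin (suc (suc d)) → Fin (suc (k P))) → ¬ AffIndep (λ i → verts P (idx i)))

-- coefficient of x^m in x^j/(1-x)^{d+1}: binom(m-j+d, d) if j ≤ m, else 0
negBinom : ℕ → ℕ → ℕ → ℕ
negBinom d zero    m       = (m ℕ.+ d) C d
negBinom d (suc j) zero    = 0
negBinom d (suc j) (suc m) = negBinom d j m

-- polynomials as coefficient lists (constant term first)
coeff : List ℤ → ℕ → ℤ
coeff []       k       = + 0
coeff (a ∷ as) zero    = a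
coeff (a ∷ as) (suc k) = coeff as k

-- h is the h*-polynomial of P, where d = dim P:
-- deg h ≤ d and Σ_m E_P(m) x^m = h(x)/(1-x)^{d+1}, compared coefficientwise
HStar : ∀ {n} → LatticePolytope n → List ℤ → Set
HStar P h =
  Σ ℕ λ d → Dim P d × (length h ≡ suc d) ×
    ((m : ℕ) → Σ ℕ λ e → EhrhartCount P m e ×
       (+ e ≡ sumℤ d (λ j → coeff h j ℤ.* + negBinom d j m)))

dilTrans : ∀ {n} → ℕ → Vec ℤ n → LatticePolytope n → LatticePolytope n
dilTrans c t P = record
  { k = k P
  ; verts = λ i → zipWith (λ a b → (+ c) ℤ.* a ℤ.- b) (verts P i) t }

dotℚ : ∀ {n} → Vec ℤ n → Vec ℚ n → ℚ
dotℚ {n} v y = sumℚ {n} (λ c → ℤtoℚ (lookup v c) ℚ.* lookup y c)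

-- origin in the interior: some box [-ε,ε]ⁿ, ε > 0, lies in P
OriginInterior : ∀ {n} → LatticePolytope n → Set
OriginInterior {n} P =
  Σ ℚ λ ε → (0ℚ ℚ.< ε) ×
    ((y : Vec ℚ n) → (∀ c → (ℚ.- ε ℚ.≤ lookup y c) × (lookup y c ℚ.≤ ε)) →
       InDilate P 1ℚ y)

-- the polar dual P* = {y | ⟨x,y⟩ ≥ -1 for all x ∈ P} is a lattice polytope
-- (checking the vertices of P suffices by linearity)
PolarIsLattice : ∀ {n} → LatticePolytope n → Set
PolarIsLattice {n} P =
  Σ (LatticePolytope n) λ Q → (y : Vec ℚ n) →
    ((∀ i → ℚ.- 1ℚ ℚ.≤ dotℚ (verts P i) y) → InDilate Q 1ℚ y) ×
    (InDilate Q 1ℚ y → ∀ i → ℚ.- 1ℚ ℚ.≤ dotℚ (verts P i) y)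

Reflexive : ∀ {n} → LatticePolytope n → Set
Reflexive P = OriginInterior P × PolarIsLattice P

Gorenstein : ∀ {n} → LatticePolytope n → Set
Gorenstein {n} P =
  Σ ℕ λ c → (1 ℕ.≤ c) × Σ (Vec ℤ n) λ t → Reflexive (dilTrans c t P)

Degree : List ℤ → ℕ → Set
Degree p s = (coeff p s ≢ + 0) × (∀ j → s ℕ.< j → coeff p j ≡ + 0)

Palindromic : List ℤ → ℕ → Set
Palindromic p s = ∀ j → j ℕ.≤ s → coeff p j ≡ coeff p (s ℕ.∸ j)

-- coefficient of x^k in x^j (1+x)^a : binom(a, k-j) if j ≤ k, else 0
shiftBinom : ℕ → ℕ → ℕ → ℕ
shiftBinom a zero    k       = a C k
shiftBinom a (suc j) zero    = 0
shiftBinom a (suc j) (suc k) = shiftBinom a j k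

GammaPositive : List ℤ → Set
GammaPositive p =
  Σ ℕ λ s → Degree p s × Palindromic p s ×
    Σ (ℕ → ℤ) λ γ → (∀ j → j ℕ.≤ s ℕ./ 2 → + 0 ℤ.≤ γ j) ×
      (∀ i → coeff p i ≡
         sumℤ (s ℕ./ 2) (λ j → γ j ℤ.* + shiftBinom (s ℕ.∸ 2 ℕ.* j) j i))

LogConcave : List ℤ → Set
LogConcave p =
  Σ ℕ λ s → Degree p s ×
    (∀ j → j ℕ.≤ s → + 0 ℤ.< coeff p j) ×
    (∀ j → 1 ℕ.≤ j → suc j ℕ.≤ s →
       coeff p (j ℕ.∸ 1) ℤ.* coeff p (suc j) ℤ.≤ coeff p j ℤ.* coeff p j)

-- Both examples are lattice simplices P = conv(v₀, …, vₙ) ⊆ ℝⁿ. Let W be the integer matrix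
-- with columns (1, vᵢ) and A an integer matrix with A W = W A = D · I. The barycentric
-- coordinates of y at height q are A (q, y) / D, so y ∈ q·P iff A (q, y) ≥ 0. Every lattice
-- point of the cone over P is uniquely b + W κ with κ ∈ ℕⁿ⁺¹ and b a lattice point of the
-- half-open parallelepiped 0 ≤ A b < D; hence E_P(m) = Σ_b binom(m − b₀ + n, n), i.e. h*ⱼ
-- counts the points b of height b₀ = j. P is reflexive when A (1, y) ≥ 0 on a box around 0
-- and the simplex whose facet normals are the vertices of P is a lattice polytope.
-- The triangle conv{(−1,−1), (1,0), (0,1)} is reflexive with h* = 1 + x + x², log-concave
-- but with γ₁ = 1 − 2 < 0; a reflexive 4-simplex has h* = 1 + 4x + 22x² + 4x³ + x⁴
-- = (1 + x)⁴ + 16 x², γ-positive but not log-concave since 4² < 1 · 22.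

module Submission where

open import Defs

open import Level using (_⊔_)
open import Function using (_∘_)
open import Function.Bundles using (_⇔_; mk⇔; Equivalence)
open import Data.Empty using (⊥-elim)
open import Data.Product using (Σ; _×_; _,_; proj₁; proj₂)
open import Data.Sum using (inj₁; inj₂)
open import Relation.Binary.Definitions using (tri<; tri≈; tri>)
open import Relation.Binary.PropositionalEquality
  using (_≡_; _≢_; refl; sym; trans; cong; cong₂; subst; subst₂; module ≡-Reasoning)
open import Relation.Nullary using (¬_; yes; no; contradiction)
open import Relation.Nullary.Decidable as Dec using (Dec; _×-dec_; True; toWitness; from-yes; from-no)

open import Algebra.Bundles using (CommutativeSemiring; CommutativeRing)
import Algebra.Properties.AbelianGroup as AbelianGroupProperties
import Algebra.Properties.CommutativeSemigroup as CommutativeSemigroupProperties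
import Algebra.Properties.Semiring.Sum as SemiringSum

open import Data.Nat as ℕ using (ℕ; zero; suc)
import Data.Nat.Properties as ℕP
open import Data.Nat.Combinatorics using (_C_; nCn≡1; nCk+nC[k+1]≡[n+1]C[k+1])
open import Data.Nat.Divisibility using (n∣m*n)
open import Data.Nat.DivMod
  using (_/_; _%_; +-distrib-/-∣ʳ; m<n⇒m/n≡0; m*n/n≡m; [m+kn]%n≡m%n; m<n⇒m%n≡m; m≡m%n+[m/n]*n; m%n<n)
import Data.Nat.ListAction as ListSum
open import Data.Integer as ℤ using (ℤ; +_; -[1+_])
import Data.Integer.Properties as ℤP
open import Data.Integer.Solver using () renaming (module +-*-Solver to ZS)
open import Data.Rational as ℚ using (ℚ; 0ℚ; 1ℚ; mkℚ)
import Data.Rational.Properties as ℚP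
open import Data.Rational.Solver using (module +-*-Solver)
open +-*-Solver using (solve; _:+_; _:*_; :-_; _:-_; _:=_; con)
import Data.Rational.Unnormalised as ℚᵘ
import Data.Rational.Unnormalised.Properties as ℚᵘP
import Data.Nat.Coprimality as Coprimality

open import Data.Fin as Fin using (Fin; zero; suc)
import Data.Fin.Properties as FinP
open import Data.Vec as Vec using (Vec; []; _∷_; lookup)
import Data.Vec.Properties as VecP
open import Data.List as List using (List; []; _∷_; length)
import Data.List.Properties as ListP
open import Data.List.Membership.Propositional using (_∈_; find; lose)
import Data.List.Membership.Propositional.Properties as MembershipP
open import Data.List.Relation.Unary.Any using (here; there)
open import Data.List.Relation.Unary.All as All using (All; []; _∷_)
import Data.List.Relation.Unary.All.Properties as AllP
open import Data.List.Relation.Unary.AllPairs using ([]; _∷_)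
open import Data.List.Relation.Unary.Unique.Propositional using (Unique)
import Data.List.Relation.Unary.Unique.Propositional.Properties as UniqueP

ℤtoℚ≡mkℚ : ∀ a → ℤtoℚ a ≡ mkℚ a 0 (Coprimality.sym (Coprimality.1-coprimeTo ℤ.∣ a ∣))
ℤtoℚ≡mkℚ (+ n)    = ℚP.normalize-coprime (Coprimality.sym (Coprimality.1-coprimeTo n))
ℤtoℚ≡mkℚ -[1+ n ] = cong ℚ.-_ (ℚP.normalize-coprime (Coprimality.sym (Coprimality.1-coprimeTo (suc n))))

toℚᵘ-ℤtoℚ : ∀ a → ℚ.toℚᵘ (ℤtoℚ a) ℚᵘ.≃ ℚᵘ.mkℚᵘ a 0
toℚᵘ-ℤtoℚ a = ℚP.toℚᵘ-fromℚᵘ (ℚᵘ.mkℚᵘ a 0)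

ℤtoℚ-+ : ∀ a b → ℤtoℚ (a ℤ.+ b) ≡ ℤtoℚ a ℚ.+ ℤtoℚ b
ℤtoℚ-+ a b = ℚP.toℚᵘ-injective (begin-equality
  ℚ.toℚᵘ (ℤtoℚ (a ℤ.+ b))        ≃⟨ toℚᵘ-ℤtoℚ (a ℤ.+ b) ⟩
  ℚᵘ.mkℚᵘ (a ℤ.+ b) 0             ≃⟨ ℚᵘ.*≡* (cong (ℤ._* + 1) (cong₂ ℤ._+_ (ℤP.*-identityʳ a) (ℤP.*-identityʳ b))) ⟨
  ℚᵘ.mkℚᵘ a 0 ℚᵘ.+ ℚᵘ.mkℚᵘ b 0   ≃⟨ ℚᵘP.+-cong (toℚᵘ-ℤtoℚ a) (toℚᵘ-ℤtoℚ b) ⟨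
  ℚ.toℚᵘ (ℤtoℚ a) ℚᵘ.+ ℚ.toℚᵘ (ℤtoℚ b) ≃⟨ ℚP.toℚᵘ-homo-+ (ℤtoℚ a) (ℤtoℚ b) ⟨
  ℚ.toℚᵘ (ℤtoℚ a ℚ.+ ℤtoℚ b) ∎)
  where open ℚᵘP.≤-Reasoning

ℤtoℚ-* : ∀ a b → ℤtoℚ (a ℤ.* b) ≡ ℤtoℚ a ℚ.* ℤtoℚ b
ℤtoℚ-* a b = ℚP.toℚᵘ-injective (begin-equality
  ℚ.toℚᵘ (ℤtoℚ (a ℤ.* b))        ≃⟨ toℚᵘ-ℤtoℚ (a ℤ.* b) ⟩
  ℚᵘ.mkℚᵘ (a ℤ.* b) 0             ≃⟨ ℚᵘ.*≡* refl ⟩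
  ℚᵘ.mkℚᵘ a 0 ℚᵘ.* ℚᵘ.mkℚᵘ b 0   ≃⟨ ℚᵘP.*-cong (toℚᵘ-ℤtoℚ a) (toℚᵘ-ℤtoℚ b) ⟨
  ℚ.toℚᵘ (ℤtoℚ a) ℚᵘ.* ℚ.toℚᵘ (ℤtoℚ b) ≃⟨ ℚP.toℚᵘ-homo-* (ℤtoℚ a) (ℤtoℚ b) ⟨
  ℚ.toℚᵘ (ℤtoℚ a ℚ.* ℤtoℚ b) ∎)
  where open ℚᵘP.≤-Reasoning

ℤtoℚ-neg : ∀ a → ℤtoℚ (ℤ.- a) ≡ ℚ.- ℤtoℚ a
ℤtoℚ-neg a = ℚP.toℚᵘ-injective (begin-equality
  ℚ.toℚᵘ (ℤtoℚ (ℤ.- a))   ≃⟨ toℚᵘ-ℤtoℚ (ℤ.- a) ⟩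
  ℚᵘ.mkℚᵘ (ℤ.- a) 0        ≃⟨ ℚᵘP.-‿cong (toℚᵘ-ℤtoℚ a) ⟨
  ℚᵘ.- ℚ.toℚᵘ (ℤtoℚ a)    ≃⟨ ℚP.toℚᵘ-homo‿- (ℤtoℚ a) ⟨
  ℚ.toℚᵘ (ℚ.- ℤtoℚ a)     ∎)
  where open ℚᵘP.≤-Reasoning

ℤtoℚ-- : ∀ a b → ℤtoℚ (a ℤ.- b) ≡ ℤtoℚ a ℚ.- ℤtoℚ b
ℤtoℚ-- a b = trans (ℤtoℚ-+ a (ℤ.- b)) (cong (ℤtoℚ a ℚ.+_) (ℤtoℚ-neg b))

ℤtoℚ-mono-≤ : ∀ {a b} → a ℤ.≤ b → ℤtoℚ a ℚ.≤ ℤtoℚ b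
ℤtoℚ-mono-≤ {a} {b} a≤b rewrite ℤtoℚ≡mkℚ a | ℤtoℚ≡mkℚ b =
  ℚ.*≤* (subst₂ ℤ._≤_ (sym (ℤP.*-identityʳ a)) (sym (ℤP.*-identityʳ b)) a≤b)

ℤtoℚ-cancel-≤ : ∀ {a b} → ℤtoℚ a ℚ.≤ ℤtoℚ b → a ℤ.≤ b
ℤtoℚ-cancel-≤ {a} {b} p rewrite ℤtoℚ≡mkℚ a | ℤtoℚ≡mkℚ b with p
... | ℚ.*≤* q = subst₂ ℤ._≤_ (ℤP.*-identityʳ a) (ℤP.*-identityʳ b) q

ℕtoℚ-nonNeg : ∀ m → 0ℚ ℚ.≤ ℕtoℚ m
ℕtoℚ-nonNeg m = ℤtoℚ-mono-≤ {+ 0} {+ m} (ℤ.+≤+ ℕ.z≤n)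

ℤtoℚ-positive : ∀ k .{{_ : ℕ.NonZero k}} → ℚ.Positive (ℤtoℚ (+ k))
ℤtoℚ-positive (suc k) = subst ℚ.Positive (sym (ℤtoℚ≡mkℚ (+ suc k))) _

*-nonNeg : ∀ {p q} → 0ℚ ℚ.≤ p → 0ℚ ℚ.≤ q → 0ℚ ℚ.≤ p ℚ.* q
*-nonNeg {p} {q} p≥0 q≥0 =
  ℚP.nonNegative⁻¹ _ {{ℚP.nonNeg*nonNeg⇒nonNeg p {{ℚ.nonNegative p≥0}} q {{ℚ.nonNegative q≥0}}}}

inverse-nonNeg : ∀ {p q} → 0ℚ ℚ.≤ p → p ℚ.* q ≡ 1ℚ → 0ℚ ℚ.≤ q
inverse-nonNeg {p} {q} p≥0 pq≡1 = ℚP.≮⇒≥ λ q<0 → 1≰0 (begin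
  1ℚ       ≡⟨ pq≡1 ⟨
  p ℚ.* q  ≤⟨ ℚP.*-monoʳ-≤-nonPos q {{ℚ.nonPositive (ℚP.<⇒≤ q<0)}} p≥0 ⟩
  0ℚ ℚ.* q ≡⟨ ℚP.*-zeroˡ q ⟩
  0ℚ       ∎)
  where
  open ℚP.≤-Reasoning
  1≰0 : ¬ (1ℚ ℚ.≤ 0ℚ)
  1≰0 (ℚ.*≤* (ℤ.+≤+ ()))

inverse-nonZero : ∀ d {q} → ℤtoℚ (+ d) ℚ.* q ≡ 1ℚ → ℕ.NonZero d
inverse-nonZero zero    {q} 0q≡1 with () ← trans (sym (ℚP.*-zeroˡ q)) 0q≡1
inverse-nonZero (suc d) _       = _

module MatrixAlgebra {c ℓ} (R : CommutativeSemiring c ℓ) where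

  open CommutativeSemiring R
    using (Carrier; _≈_; _+_; _*_; 0#; setoid; +-cong; +-congˡ; *-congˡ; *-congʳ;
           *-assoc; *-comm; +-identityˡ; +-identityʳ; zeroˡ; zeroʳ; distribʳ; semiring)
    renaming (refl to ≈-refl; sym to ≈-sym; trans to ≈-trans; reflexive to ≈-reflexive)
  open SemiringSum semiring using (sum; sum-cong-≋; sum-replicate-zero; ∑-comm; ∑-distrib-+; *-distribˡ-sum; *-distribʳ-sum)
  open import Relation.Binary.Reasoning.Setoid setoid

  Matrix : ℕ → ℕ → Set c
  Matrix m n = Fin m → Fin n → Carrier

  infixr 7 _⊙_ _⊗_

  -- Matrix–vector product, with the vector entry written first as in InDilate.
  _⊙_ : ∀ {m n} → Matrix m n → (Fin n → Carrier) → Fin m → Carrier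
  (M ⊙ x) i = sum (λ k → x k * M i k)

  _⊗_ : ∀ {l m n} → Matrix l m → Matrix m n → Matrix l n
  (M ⊗ N) i k = sum (λ j → M i j * N j k)

  scalarMatrix : ∀ {n} → Carrier → Matrix n n
  scalarMatrix d i k with i Fin.≟ k
  ... | yes _ = d
  ... | no  _ = 0#

  ⊙-congˡ : ∀ {m n} {M N : Matrix m n} → (∀ i k → M i k ≈ N i k) → ∀ x i → (M ⊙ x) i ≈ (N ⊙ x) i
  ⊙-congˡ M≈N x i = sum-cong-≋ (λ k → *-congˡ (M≈N i k))

  ⊙-congʳ : ∀ {m n} (M : Matrix m n) {x y} → (∀ k → x k ≈ y k) → ∀ i → (M ⊙ x) i ≈ (M ⊙ y) i
  ⊙-congʳ M x≈y i = sum-cong-≋ (λ k → *-congʳ (x≈y k))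

  ⊙-⊗ : ∀ {l m n} (M : Matrix l m) (N : Matrix m n) x i → (M ⊙ N ⊙ x) i ≈ ((M ⊗ N) ⊙ x) i
  ⊙-⊗ M N x i = begin
    sum (λ j → sum (λ k → x k * N j k) * M i j)    ≈⟨ sum-cong-≋ (λ j → *-distribʳ-sum (M i j) (λ k → x k * N j k)) ⟩
    sum (λ j → sum (λ k → x k * N j k * M i j))    ≈⟨ ∑-comm (λ j k → x k * N j k * M i j) ⟩
    sum (λ k → sum (λ j → x k * N j k * M i j))
      ≈⟨ sum-cong-≋ (λ k → sum-cong-≋ (λ j → rearrange (x k) (N j k) (M i j))) ⟩
    sum (λ k → sum (λ j → x k * (M i j * N j k)))  ≈⟨ sum-cong-≋ (λ k → *-distribˡ-sum (x k) (λ j → M i j * N j k)) ⟨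
    sum (λ k → x k * (M ⊗ N) i k)                  ∎
    where
    rearrange : ∀ a b c → a * b * c ≈ a * (c * b)
    rearrange a b c = ≈-trans (*-assoc a b c) (*-congˡ (*-comm b c))

  ⊙-+ : ∀ {m n} (M : Matrix m n) x y i → (M ⊙ (λ k → x k + y k)) i ≈ (M ⊙ x) i + (M ⊙ y) i
  ⊙-+ M x y i = ≈-trans (sum-cong-≋ (λ k → distribʳ (M i k) (x k) (y k)))
                        (∑-distrib-+ (λ k → x k * M i k) (λ k → y k * M i k))

  ⊙-*ʳ : ∀ {m n} (M : Matrix m n) x s i → (M ⊙ (λ k → x k * s)) i ≈ (M ⊙ x) i * s
  ⊙-*ʳ M x s i = ≈-trans (sum-cong-≋ (λ k → swap (x k) s (M i k)))
                         (≈-sym (*-distribʳ-sum s (λ k → x k * M i k)))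
    where
    swap : ∀ a b c → a * b * c ≈ a * c * b
    swap a b c = ≈-trans (*-assoc a b c) (≈-trans (*-congˡ (*-comm b c)) (≈-sym (*-assoc a c b)))

  scalarMatrix-diagonal : ∀ {n} d (i : Fin n) → scalarMatrix d i i ≡ d
  scalarMatrix-diagonal d i with i Fin.≟ i
  ... | yes _   = refl
  ... | no i≢i = ⊥-elim (i≢i refl)

  scalarMatrix-offDiagonal : ∀ {n} d {i k : Fin n} → i ≢ k → scalarMatrix d i k ≡ 0#
  scalarMatrix-offDiagonal d {i} {k} i≢k with i Fin.≟ k
  ... | yes i≡k = ⊥-elim (i≢k i≡k)
  ... | no  _   = refl

  ⊙-zero : ∀ {m n} (M : Matrix m n) i → (M ⊙ (λ _ → 0#)) i ≈ 0#
  ⊙-zero {n = n} M i = ≈-trans (sum-cong-≋ (λ k → zeroˡ (M i k))) (sum-replicate-zero n)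

  scalarMatrix-⊙ : ∀ {n} d (x : Fin n → Carrier) i → (scalarMatrix d ⊙ x) i ≈ x i * d
  scalarMatrix-⊙ {suc n} d x zero = begin
    x zero * scalarMatrix {suc n} d zero zero + sum (λ k → x (suc k) * scalarMatrix d zero (suc k))
      ≈⟨ +-cong (*-congˡ (≈-reflexive (scalarMatrix-diagonal {suc n} d zero)))
                (sum-cong-≋ (λ k → *-congˡ (≈-reflexive (scalarMatrix-offDiagonal {suc n} d {zero} {suc k} λ ())))) ⟩
    x zero * d + sum {n} (λ k → x (suc k) * 0#)
      ≈⟨ +-congˡ (≈-trans (sum-cong-≋ (λ k → zeroʳ (x (suc k)))) (sum-replicate-zero n)) ⟩
    x zero * d + 0#                              ≈⟨ +-identityʳ _ ⟩
    x zero * d                                   ∎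
  scalarMatrix-⊙ {suc n} d x (suc i) = begin
    x zero * scalarMatrix d (suc i) zero + sum (λ k → x (suc k) * scalarMatrix d (suc i) (suc k))
      ≈⟨ +-cong (*-congˡ (≈-reflexive (scalarMatrix-offDiagonal {suc n} d {suc i} {zero} λ ())))
                (sum-cong-≋ (λ k → *-congˡ (≈-reflexive (shift k)))) ⟩
    x zero * 0# + (scalarMatrix d ⊙ (x ∘ suc)) i  ≈⟨ +-cong (zeroʳ (x zero)) (scalarMatrix-⊙ d (x ∘ suc) i) ⟩
    0# + x (suc i) * d                            ≈⟨ +-identityˡ _ ⟩
    x (suc i) * d                                 ∎
    where
    shift : ∀ k → scalarMatrix d (suc i) (suc k) ≡ scalarMatrix d i k
    shift k with i Fin.≟ k
    ... | yes _ = refl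
    ... | no  _ = refl

  record IsScaledInverse {n} (W A : Matrix n n) (d : Carrier) : Set (c ⊔ ℓ) where
    field
      A⊗W : ∀ i k → (A ⊗ W) i k ≈ scalarMatrix d i k
      W⊗A : ∀ i k → (W ⊗ A) i k ≈ scalarMatrix d i k

  module _ {n} {W A : Matrix n n} {d} (inv : IsScaledInverse W A d) where
    open IsScaledInverse inv

    scaledInverse-⊙ˡ : ∀ x i → (A ⊙ W ⊙ x) i ≈ x i * d
    scaledInverse-⊙ˡ x i =
      ≈-trans (⊙-⊗ A W x i) (≈-trans (⊙-congˡ A⊗W x i) (scalarMatrix-⊙ d x i))

    scaledInverse-⊙ʳ : ∀ x i → (W ⊙ A ⊙ x) i ≈ x i * d
    scaledInverse-⊙ʳ x i =
      ≈-trans (⊙-⊗ W A x i) (≈-trans (⊙-congˡ W⊗A x i) (scalarMatrix-⊙ d x i))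

module ℤ+Group = AbelianGroupProperties ℤP.+-0-abelianGroup
module ℤ+Semigroup = CommutativeSemigroupProperties ℤP.+-commutativeSemigroup
module ℤMatrix = MatrixAlgebra ℤP.+-*-commutativeSemiring
module ℚMatrix = MatrixAlgebra (CommutativeRing.commutativeSemiring ℚP.+-*-commutativeRing)
module ℤΣ = SemiringSum ℤP.+-*-semiring
module ℚΣ = SemiringSum (CommutativeRing.semiring ℚP.+-*-commutativeRing)

open ℤMatrix using (Matrix; _⊙_; _⊗_; scalarMatrix; IsScaledInverse)

toℚMatrix : ∀ {m n} → Matrix m n → ℚMatrix.Matrix m n
toℚMatrix M i k = ℤtoℚ (M i k)

sumℚ≡sum : ∀ {n} (f : Fin n → ℚ) → sumℚ f ≡ ℚΣ.sum f
sumℚ≡sum {zero}  f = refl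
sumℚ≡sum {suc n} f = cong (f zero ℚ.+_) (sumℚ≡sum (f ∘ suc))

ℤtoℚ-sum : ∀ {n} (f : Fin n → ℤ) → ℤtoℚ (ℤΣ.sum f) ≡ ℚΣ.sum (ℤtoℚ ∘ f)
ℤtoℚ-sum {zero}  f = refl
ℤtoℚ-sum {suc n} f = trans (ℤtoℚ-+ (f zero) _) (cong (ℤtoℚ (f zero) ℚ.+_) (ℤtoℚ-sum (f ∘ suc)))

ℤtoℚ-⊙ : ∀ {m n} (M : Matrix m n) v i → ℤtoℚ ((M ⊙ v) i) ≡ (toℚMatrix M ℚMatrix.⊙ (ℤtoℚ ∘ v)) i
ℤtoℚ-⊙ M v i = trans (ℤtoℚ-sum (λ k → v k ℤ.* M i k)) (ℚΣ.sum-cong-≗ (λ k → ℤtoℚ-* (v k) (M i k)))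

toℚMatrix-⊗ : ∀ {l m n} (M : Matrix l m) (N : Matrix m n) i k →
              toℚMatrix (M ⊗ N) i k ≡ (toℚMatrix M ℚMatrix.⊗ toℚMatrix N) i k
toℚMatrix-⊗ M N i k = trans (ℤtoℚ-sum (λ j → M i j ℤ.* N j k)) (ℚΣ.sum-cong-≗ (λ j → ℤtoℚ-* (M i j) (N j k)))

toℚMatrix-scalarMatrix : ∀ {n} d (i k : Fin n) →
                         toℚMatrix (scalarMatrix d) i k ≡ ℚMatrix.scalarMatrix (ℤtoℚ d) i k
toℚMatrix-scalarMatrix d i k with i Fin.≟ k
... | yes _ = refl
... | no  _ = refl

toℚ-isScaledInverse : ∀ {n} {W A : Matrix n n} {d} → IsScaledInverse W A d →
                      ℚMatrix.IsScaledInverse (toℚMatrix W) (toℚMatrix A) (ℤtoℚ d)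
toℚ-isScaledInverse {W = W} {A} {d} inv = record
  { A⊗W = λ i k → trans (sym (toℚMatrix-⊗ A W i k)) (trans (cong ℤtoℚ (A⊗W i k)) (toℚMatrix-scalarMatrix d i k))
  ; W⊗A = λ i k → trans (sym (toℚMatrix-⊗ W A i k)) (trans (cong ℤtoℚ (W⊗A i k)) (toℚMatrix-scalarMatrix d i k))
  }
  where open IsScaledInverse inv

isScaledInverse? : ∀ {n} (W A : Matrix n n) d → Dec (IsScaledInverse W A d)
isScaledInverse? W A d = Dec.map′ (λ (A⊗W , W⊗A) → record { A⊗W = A⊗W ; W⊗A = W⊗A })
  (λ inv → IsScaledInverse.A⊗W inv , IsScaledInverse.W⊗A inv)
  (FinP.all? (λ i → FinP.all? (λ k → (A ⊗ W) i k ℤ.≟ scalarMatrix d i k)) ×-dec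
   FinP.all? (λ i → FinP.all? (λ k → (W ⊗ A) i k ℤ.≟ scalarMatrix d i k)))

sumℤ-mono-≤ : ∀ {n} {f g : Fin n → ℤ} → (∀ i → f i ℤ.≤ g i) → ℤΣ.sum f ℤ.≤ ℤΣ.sum g
sumℤ-mono-≤ {zero}  f≤g = ℤP.≤-refl
sumℤ-mono-≤ {suc n} f≤g = ℤP.+-mono-≤ (f≤g zero) (sumℤ-mono-≤ (f≤g ∘ suc))

sumℤ-mono-< : ∀ {n} {f g : Fin (suc n) → ℤ} → (∀ i → f i ℤ.< g i) → ℤΣ.sum f ℤ.< ℤΣ.sum g
sumℤ-mono-< f<g = ℤP.+-mono-<-≤ (f<g zero) (sumℤ-mono-≤ (ℤP.<⇒≤ ∘ f<g ∘ suc))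

sumℤ-const : ∀ n c → ℤΣ.sum {n} (λ _ → c) ≡ + n ℤ.* c
sumℤ-const zero    c = sym (ℤP.*-zeroˡ c)
sumℤ-const (suc n) c = begin
  c ℤ.+ ℤΣ.sum {n} (λ _ → c)  ≡⟨ cong (λ t → c ℤ.+ t) (sumℤ-const n c) ⟩
  c ℤ.+ + n ℤ.* c             ≡⟨ cong (ℤ._+ + n ℤ.* c) (ℤP.*-identityˡ c) ⟨
  + 1 ℤ.* c ℤ.+ + n ℤ.* c     ≡⟨ ℤP.*-distribʳ-+ c (+ 1) (+ n) ⟨
  + suc n ℤ.* c               ∎
  where open ≡-Reasoning

sumℤ-pos : ∀ {n} (κ : Vec ℕ n) → ℤΣ.sum (+_ ∘ lookup κ) ≡ + Vec.sum κ
sumℤ-pos []      = refl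
sumℤ-pos (a ∷ κ) = trans (cong (λ t → + a ℤ.+ t) (sumℤ-pos κ)) (sym (ℤP.pos-+ a (Vec.sum κ)))

sumℤ-nonNeg : ∀ {n} {f : Fin n → ℤ} → (∀ i → + 0 ℤ.≤ f i) → + 0 ℤ.≤ ℤΣ.sum f
sumℤ-nonNeg {zero}  f≥0 = ℤP.≤-refl
sumℤ-nonNeg {suc n} f≥0 = ℤP.+-mono-≤ (f≥0 zero) (sumℤ-nonNeg (f≥0 ∘ suc))

positivePart negativePart : ℤ → ℤ
positivePart (+ k)    = + k
positivePart -[1+ k ] = + 0
negativePart (+ k)    = + 0
negativePart -[1+ k ] = -[1+ k ]

*-≤-positivePart : ∀ {r d} w → + 0 ℤ.≤ r → r ℤ.≤ d → r ℤ.* w ℤ.≤ d ℤ.* positivePart w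
*-≤-positivePart (+ k)        r≥0 r≤d = ℤP.*-monoʳ-≤-nonNeg (+ k) r≤d
*-≤-positivePart {r} {d} -[1+ k ] r≥0 r≤d = begin
  r ℤ.* -[1+ k ]   ≤⟨ ℤP.*-monoʳ-≤-nonPos -[1+ k ] r≥0 ⟩
  + 0 ℤ.* -[1+ k ] ≡⟨ ℤP.*-zeroʳ d ⟨
  d ℤ.* + 0        ∎
  where open ℤP.≤-Reasoning

*-≥-negativePart : ∀ {r d} w → + 0 ℤ.≤ r → r ℤ.≤ d → d ℤ.* negativePart w ℤ.≤ r ℤ.* w
*-≥-negativePart {r} {d} (+ k) r≥0 r≤d = begin
  d ℤ.* + 0    ≡⟨ ℤP.*-zeroʳ d ⟩
  + 0 ℤ.* + k  ≤⟨ ℤP.*-monoʳ-≤-nonNeg (+ k) r≥0 ⟩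
  r ℤ.* + k    ∎
  where open ℤP.≤-Reasoning
*-≥-negativePart -[1+ k ] r≥0 r≤d = ℤP.*-monoʳ-≤-nonPos -[1+ k ] r≤d

divMod-injective : ∀ {d} .{{_ : ℕ.NonZero d}} {r r′ k k′} → r ℕ.< d → r′ ℕ.< d →
                   r ℕ.+ k ℕ.* d ≡ r′ ℕ.+ k′ ℕ.* d → r ≡ r′ × k ≡ k′
divMod-injective {d} {r} {r′} {k} {k′} r<d r′<d same =
  trans (sym (remainder r<d k)) (trans (cong (_% d) same) (remainder r′<d k′)) ,
  trans (sym (quotient r<d k)) (trans (cong (_/ d) same) (quotient r′<d k′))
  where
  remainder : ∀ {r} → r ℕ.< d → ∀ k → (r ℕ.+ k ℕ.* d) % d ≡ r
  remainder {r} r<d k = trans ([m+kn]%n≡m%n r k d) (m<n⇒m%n≡m r<d)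
  quotient : ∀ {r} → r ℕ.< d → ∀ k → (r ℕ.+ k ℕ.* d) / d ≡ k
  quotient {r} r<d k = trans (+-distrib-/-∣ʳ r (n∣m*n k)) (cong₂ ℕ._+_ (m<n⇒m/n≡0 r<d) (m*n/n≡m k d))

lookup-ext : ∀ {A : Set} {n} {xs ys : Vec A n} → (∀ i → lookup xs i ≡ lookup ys i) → xs ≡ ys
lookup-ext {xs = xs} {ys} xs≗ys =
  trans (sym (VecP.tabulate∘lookup xs)) (trans (VecP.tabulate-cong xs≗ys) (VecP.tabulate∘lookup ys))

sumℚ-mono-≤ : ∀ {n} {f g : Fin n → ℚ} → (∀ i → f i ℚ.≤ g i) → ℚΣ.sum f ℚ.≤ ℚΣ.sum g
sumℚ-mono-≤ {zero}  f≤g = ℚP.≤-refl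
sumℚ-mono-≤ {suc n} f≤g = ℚP.+-mono-≤ (f≤g zero) (sumℚ-mono-≤ (f≤g ∘ suc))

sumℚ-neg : ∀ {n} (f : Fin n → ℚ) → ℚΣ.sum (λ i → ℚ.- f i) ≡ ℚ.- ℚΣ.sum f
sumℚ-neg f = begin
  ℚΣ.sum (λ i → ℚ.- f i)         ≡⟨ ℚΣ.sum-cong-≗ (λ i → neg≡-1* (f i)) ⟩
  ℚΣ.sum (λ i → ℚ.- 1ℚ ℚ.* f i)  ≡⟨ ℚΣ.*-distribˡ-sum (ℚ.- 1ℚ) f ⟨
  ℚ.- 1ℚ ℚ.* ℚΣ.sum f            ≡⟨ neg≡-1* (ℚΣ.sum f) ⟨
  ℚ.- ℚΣ.sum f                   ∎
  where
  open ≡-Reasoning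
  neg≡-1* : ∀ p → ℚ.- p ≡ ℚ.- 1ℚ ℚ.* p
  neg≡-1* p = trans (cong ℚ.-_ (sym (ℚP.*-identityˡ p))) (ℚP.neg-distribˡ-* 1ℚ p)

-ε∣a∣≤y*a : ∀ {ε y} a → ℚ.- ε ℚ.≤ y → y ℚ.≤ ε → ℚ.- (ε ℚ.* ℤtoℚ (+ ℤ.∣ a ∣)) ℚ.≤ y ℚ.* ℤtoℚ a
-ε∣a∣≤y*a {ε} {y} (+ k) -ε≤y y≤ε = subst (ℚ._≤ y ℚ.* ℤtoℚ (+ k)) (sym (ℚP.neg-distribˡ-* ε (ℤtoℚ (+ k))))
  (ℚP.*-monoʳ-≤-nonNeg (ℤtoℚ (+ k)) {{ℚ.nonNegative (ℕtoℚ-nonNeg k)}} -ε≤y)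
-ε∣a∣≤y*a {ε} {y} -[1+ k ] -ε≤y y≤ε =
  subst (ℚ._≤ y ℚ.* ℤtoℚ -[1+ k ]) (sym (ℚP.neg-distribʳ-* ε (ℤtoℚ (+ suc k))))
  (ℚP.*-monoʳ-≤-nonPos (ℤtoℚ -[1+ k ]) {{ℚ.nonPositive (ℤtoℚ-mono-≤ { -[1+ k ]} {+ 0} ℤ.-≤+)}} y≤ε)

module _ {A B : Set} where

  length-concatMap : ∀ (f : A → List B) xs → length (List.concatMap f xs) ≡ ListSum.sum (List.map (length ∘ f) xs)
  length-concatMap f []       = refl
  length-concatMap f (x ∷ xs) = trans (ListP.length-++ (f x)) (cong (length (f x) ℕ.+_) (length-concatMap f xs))

  concatMap-unique : ∀ (f : A → List B) {xs} → Unique xs → (∀ {x} → x ∈ xs → Unique (f x)) →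
                     (∀ {x y v} → x ∈ xs → y ∈ xs → v ∈ f x → v ∈ f y → x ≡ y) → Unique (List.concatMap f xs)
  concatMap-unique f {[]}     []             fx-unique disjoint = []
  concatMap-unique f {x ∷ xs} (x∉xs ∷ xs-unique) fx-unique disjoint =
    UniqueP.++⁺ (fx-unique (here refl))
                (concatMap-unique f xs-unique (fx-unique ∘ there) (λ p q → disjoint (there p) (there q)))
                separated
    where
    separated : ∀ {v} → ¬ (v ∈ f x × v ∈ List.concatMap f xs)
    separated (v∈fx , v∈rest) with find (MembershipP.∈-concatMap⁻ f {xs = xs} v∈rest)
    ... | y , y∈xs , v∈fy = All.lookup x∉xs y∈xs (disjoint (here refl) (there y∈xs) v∈fx v∈fy)

  map-unique : ∀ (f : A → B) {xs} → Unique xs →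
               (∀ {x y} → x ∈ xs → y ∈ xs → f x ≡ f y → x ≡ y) → Unique (List.map f xs)
  map-unique f {[]}     []                 injective = []
  map-unique f {x ∷ xs} (x∉xs ∷ xs-unique) injective =
    AllP.map⁺ (All.tabulate (λ y∈xs fx≡fy → All.lookup x∉xs y∈xs (injective (here refl) (there y∈xs) fx≡fy))) ∷
    map-unique f xs-unique (λ p q → injective (there p) (there q))

range : ℤ → ℤ → List ℤ
range l h = List.map (λ t → l ℤ.+ + t) (List.upTo (suc ℤ.∣ h ℤ.- l ∣))

∈-range : ∀ {l h a} → l ℤ.≤ a → a ℤ.≤ h → a ∈ range l h
∈-range {l} {h} {a} l≤a a≤h =
  subst (_∈ range l h) a≡l+t (MembershipP.∈-map⁺ (λ t → l ℤ.+ + t) (MembershipP.∈-upTo⁺ (ℕ.s≤s t≤h-l)))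
  where
  t : ℕ
  t = ℤ.∣ a ℤ.- l ∣
  +t≡a-l : + t ≡ a ℤ.- l
  +t≡a-l = ℤP.0≤i⇒+∣i∣≡i (ℤP.i≤j⇒0≤j-i l≤a)
  a≡l+t : l ℤ.+ + t ≡ a
  a≡l+t = trans (ℤP.+-comm l (+ t)) (trans (cong (ℤ._+ l) +t≡a-l) (ℤ+Group.//-rightDividesˡ l a))
  t≤h-l : t ℕ.≤ ℤ.∣ h ℤ.- l ∣
  t≤h-l = ℤP.drop‿+≤+ (subst₂ ℤ._≤_ (sym +t≡a-l) (sym (ℤP.0≤i⇒+∣i∣≡i (ℤP.i≤j⇒0≤j-i (ℤP.≤-trans l≤a a≤h))))
                                    (ℤP.+-monoˡ-≤ (ℤ.- l) a≤h))

range-unique : ∀ l h → Unique (range l h)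
range-unique l h = UniqueP.map⁺ (λ l+s≡l+t → ℤP.+-injective (ℤ+Group.∙-cancelˡ l _ _ l+s≡l+t)) (UniqueP.upTo⁺ _)

grid : ∀ {K} → (Fin K → ℤ) → (Fin K → ℤ) → List (Vec ℤ K)
grid {zero}  lo hi = [] ∷ []
grid {suc K} lo hi = List.cartesianProductWith _∷_ (range (lo zero) (hi zero)) (grid (lo ∘ suc) (hi ∘ suc))

∈-grid : ∀ {K} {lo hi : Fin K → ℤ} b → (∀ j → lo j ℤ.≤ lookup b j × lookup b j ℤ.≤ hi j) → b ∈ grid lo hi
∈-grid []      bounded = here refl
∈-grid (a ∷ b) bounded = MembershipP.∈-cartesianProductWith⁺ _∷_
  (∈-range (proj₁ (bounded zero)) (proj₂ (bounded zero))) (∈-grid b (bounded ∘ suc))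

grid-unique : ∀ {K} (lo hi : Fin K → ℤ) → Unique (grid lo hi)
grid-unique {zero}  lo hi = [] ∷ []
grid-unique {suc K} lo hi =
  UniqueP.cartesianProductWith⁺ _∷_ VecP.∷-injective (range-unique (lo zero) (hi zero)) (grid-unique (lo ∘ suc) (hi ∘ suc))

incrementHead : ∀ {N} → Vec ℕ (suc N) → Vec ℕ (suc N)
incrementHead (a ∷ κ) = suc a ∷ κ

incrementHead-injective : ∀ {N} {κ κ′ : Vec ℕ (suc N)} → incrementHead κ ≡ incrementHead κ′ → κ ≡ κ′
incrementHead-injective {κ = _ ∷ _} {_ ∷ _} refl = refl

compositions : (N s : ℕ) → List (Vec ℕ N)
compositions zero    zero    = [] ∷ []
compositions zero    (suc s) = []
compositions (suc N) zero    = List.map (0 ∷_) (compositions N zero)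
compositions (suc N) (suc s) =
  List.map (0 ∷_) (compositions N (suc s)) List.++ List.map incrementHead (compositions (suc N) s)

length-compositions : ∀ d s → length (compositions (suc d) s) ≡ (s ℕ.+ d) C d
length-compositions zero    zero    = refl
length-compositions zero    (suc s) = trans (ListP.length-map incrementHead (compositions 1 s)) (length-compositions zero s)
length-compositions (suc d) zero    =
  trans (ListP.length-map (0 ∷_) (compositions (suc d) zero))
        (trans (length-compositions d zero) (trans (nCn≡1 d) (sym (nCn≡1 (suc d)))))
length-compositions (suc d) (suc s) = begin
  length (List.map (0 ∷_) (compositions (suc d) (suc s)) List.++ List.map incrementHead (compositions (suc (suc d)) s))
    ≡⟨ ListP.length-++ (List.map (0 ∷_) (compositions (suc d) (suc s))) ⟩
  length (List.map (0 ∷_) (compositions (suc d) (suc s))) ℕ.+ length (List.map incrementHead (compositions (suc (suc d)) s))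
    ≡⟨ cong₂ ℕ._+_ (ListP.length-map (0 ∷_) (compositions (suc d) (suc s)))
                   (ListP.length-map incrementHead (compositions (suc (suc d)) s)) ⟩
  length (compositions (suc d) (suc s)) ℕ.+ length (compositions (suc (suc d)) s)
    ≡⟨ cong₂ ℕ._+_ (length-compositions d (suc s)) (length-compositions (suc d) s) ⟩
  (suc s ℕ.+ d) C d ℕ.+ (s ℕ.+ suc d) C suc d
    ≡⟨ cong (λ t → (suc s ℕ.+ d) C d ℕ.+ t C suc d) (ℕP.+-suc s d) ⟩
  (suc s ℕ.+ d) C d ℕ.+ (suc s ℕ.+ d) C suc d
    ≡⟨ nCk+nC[k+1]≡[n+1]C[k+1] (suc s ℕ.+ d) d ⟩
  suc (suc s ℕ.+ d) C suc d
    ≡⟨ cong (λ t → suc t C suc d) (ℕP.+-suc s d) ⟨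
  (suc s ℕ.+ suc d) C suc d ∎
  where open ≡-Reasoning

∈-compositions⁻ : ∀ N s κ → κ ∈ compositions N s → Vec.sum κ ≡ s
∈-compositions⁻ zero    zero    []  _ = refl
∈-compositions⁻ (suc N) zero    κ   κ∈ with MembershipP.∈-map⁻ (0 ∷_) κ∈
... | κ′ , κ′∈ , refl = ∈-compositions⁻ N zero κ′ κ′∈
∈-compositions⁻ (suc N) (suc s) κ   κ∈ with MembershipP.∈-++⁻ (List.map (0 ∷_) (compositions N (suc s))) κ∈
... | inj₁ κ∈₀ with MembershipP.∈-map⁻ (0 ∷_) κ∈₀
...   | κ′ , κ′∈ , refl = ∈-compositions⁻ N (suc s) κ′ κ′∈
∈-compositions⁻ (suc N) (suc s) κ   κ∈ | inj₂ κ∈₊ with MembershipP.∈-map⁻ incrementHead κ∈₊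
...   | (a ∷ κ′) , κ′∈ , refl = cong suc (∈-compositions⁻ (suc N) s (a ∷ κ′) κ′∈)

∈-compositions⁺ : ∀ N s κ → Vec.sum κ ≡ s → κ ∈ compositions N s
∈-compositions⁺ zero    zero    []          _     = here refl
∈-compositions⁺ (suc N) zero    (zero ∷ κ)  Σκ≡0  = MembershipP.∈-map⁺ (0 ∷_) (∈-compositions⁺ N zero κ Σκ≡0)
∈-compositions⁺ (suc N) (suc s) (zero ∷ κ)  Σκ≡s  =
  MembershipP.∈-++⁺ˡ (MembershipP.∈-map⁺ (0 ∷_) (∈-compositions⁺ N (suc s) κ Σκ≡s))
∈-compositions⁺ (suc N) (suc s) (suc a ∷ κ) Σκ≡s  =
  MembershipP.∈-++⁺ʳ (List.map (0 ∷_) (compositions N (suc s)))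
    (MembershipP.∈-map⁺ incrementHead (∈-compositions⁺ (suc N) s (a ∷ κ) (ℕP.suc-injective Σκ≡s)))

compositions-unique : ∀ N s → Unique (compositions N s)
compositions-unique zero    zero    = [] ∷ []
compositions-unique zero    (suc s) = []
compositions-unique (suc N) zero    = UniqueP.map⁺ VecP.∷-injectiveʳ (compositions-unique N zero)
compositions-unique (suc N) (suc s) =
  UniqueP.++⁺ (UniqueP.map⁺ VecP.∷-injectiveʳ (compositions-unique N (suc s)))
              (UniqueP.map⁺ incrementHead-injective (compositions-unique (suc N) s)) separated
  where
  separated : ∀ {κ} → ¬ (κ ∈ List.map (0 ∷_) (compositions N (suc s)) × κ ∈ List.map incrementHead (compositions (suc N) s))
  separated (κ∈₀ , κ∈₊) with MembershipP.∈-map⁻ (0 ∷_) κ∈₀ | MembershipP.∈-map⁻ incrementHead κ∈₊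
  ... | _ , _ , refl | (a ∷ _) , _ , ()

compositionsAbove : (d h m : ℕ) → List (Vec ℕ (suc d))
compositionsAbove d zero    m       = compositions (suc d) m
compositionsAbove d (suc h) zero    = []
compositionsAbove d (suc h) (suc m) = compositionsAbove d h m

length-compositionsAbove : ∀ d h m → length (compositionsAbove d h m) ≡ negBinom d h m
length-compositionsAbove d zero    m       = length-compositions d m
length-compositionsAbove d (suc h) zero    = refl
length-compositionsAbove d (suc h) (suc m) = length-compositionsAbove d h m

∈-compositionsAbove⁻ : ∀ d h m κ → κ ∈ compositionsAbove d h m → Vec.sum κ ℕ.+ h ≡ m
∈-compositionsAbove⁻ d zero    m       κ κ∈ = trans (ℕP.+-identityʳ _) (∈-compositions⁻ (suc d) m κ κ∈)
∈-compositionsAbove⁻ d (suc h) (suc m) κ κ∈ = trans (ℕP.+-suc _ h) (cong suc (∈-compositionsAbove⁻ d h m κ κ∈))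

∈-compositionsAbove⁺ : ∀ d h m κ → Vec.sum κ ℕ.+ h ≡ m → κ ∈ compositionsAbove d h m
∈-compositionsAbove⁺ d zero    m       κ eq = ∈-compositions⁺ (suc d) m κ (trans (sym (ℕP.+-identityʳ _)) eq)
∈-compositionsAbove⁺ d (suc h) zero    κ eq = contradiction (trans (sym (ℕP.+-suc (Vec.sum κ) h)) eq) ℕP.1+n≢0
∈-compositionsAbove⁺ d (suc h) (suc m) κ eq =
  ∈-compositionsAbove⁺ d h m κ (ℕP.suc-injective (trans (sym (ℕP.+-suc (Vec.sum κ) h)) eq))

compositionsAbove-unique : ∀ d h m → Unique (compositionsAbove d h m)
compositionsAbove-unique d zero    m       = compositions-unique (suc d) m
compositionsAbove-unique d (suc h) zero    = []
compositionsAbove-unique d (suc h) (suc m) = compositionsAbove-unique d h m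

indicator : ℕ → ℕ → ℤ
indicator j h with j ℕ.≟ h
... | yes _ = + 1
... | no  _ = + 0

indicator-diagonal : ∀ j → indicator j j ≡ + 1
indicator-diagonal j with j ℕ.≟ j
... | yes _   = refl
... | no j≢j = ⊥-elim (j≢j refl)

indicator-offDiagonal : ∀ {j h} → j ≢ h → indicator j h ≡ + 0
indicator-offDiagonal {j} {h} j≢h with j ℕ.≟ h
... | yes j≡h = ⊥-elim (j≢h j≡h)
... | no  _   = refl

multiplicity : ℕ → List ℕ → ℤ
multiplicity j = List.foldr (λ h m → indicator j h ℤ.+ m) (+ 0)

sumℤ-cong : ∀ N {f g : ℕ → ℤ} → (∀ j → f j ≡ g j) → sumℤ N f ≡ sumℤ N g
sumℤ-cong zero    f≗g = f≗g zero
sumℤ-cong (suc N) f≗g = cong₂ ℤ._+_ (sumℤ-cong N f≗g) (f≗g (suc N))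

sumℤ-+ : ∀ N (f g : ℕ → ℤ) → sumℤ N (λ j → f j ℤ.+ g j) ≡ sumℤ N f ℤ.+ sumℤ N g
sumℤ-+ zero    f g = refl
sumℤ-+ (suc N) f g = trans (cong (ℤ._+ (f (suc N) ℤ.+ g (suc N))) (sumℤ-+ N f g))
                           (ℤ+Semigroup.interchange (sumℤ N f) (sumℤ N g) (f (suc N)) (g (suc N)))

sumℤ-indicator-beyond : ∀ N {h} (g : ℕ → ℤ) → N ℕ.< h → sumℤ N (λ j → indicator j h ℤ.* g j) ≡ + 0
sumℤ-indicator-beyond zero    g 0<h = cong (ℤ._* g 0) (indicator-offDiagonal (ℕP.<⇒≢ 0<h))
sumℤ-indicator-beyond (suc N) g N<h = cong₂ ℤ._+_ (sumℤ-indicator-beyond N g (ℕP.<-trans (ℕP.n<1+n N) N<h))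
                                                  (cong (ℤ._* g (suc N)) (indicator-offDiagonal (ℕP.<⇒≢ N<h)))

sumℤ-indicator : ∀ N {h} (g : ℕ → ℤ) → h ℕ.≤ N → sumℤ N (λ j → indicator j h ℤ.* g j) ≡ g h
sumℤ-indicator zero    g ℕ.z≤n = trans (cong (ℤ._* g 0) (indicator-diagonal 0)) (ℤP.*-identityˡ (g 0))
sumℤ-indicator (suc N) {h} g h≤1+N with ℕP.m≤n⇒m<n∨m≡n h≤1+N
... | inj₁ h<1+N = trans (cong₂ ℤ._+_ (sumℤ-indicator N g (ℕP.≤-pred h<1+N))
                                       (cong (ℤ._* g (suc N)) (indicator-offDiagonal (ℕP.>⇒≢ h<1+N))))
                         (ℤP.+-identityʳ (g h))
... | inj₂ refl  = trans (cong₂ ℤ._+_ (sumℤ-indicator-beyond N g (ℕP.n<1+n N))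
                                       (cong (ℤ._* g (suc N)) (indicator-diagonal (suc N))))
                         (trans (ℤP.+-identityˡ _) (ℤP.*-identityˡ (g (suc N))))

sum-by-multiplicity : ∀ d (f : ℕ → ℕ) hs → All (ℕ._≤ d) hs →
  + ListSum.sum (List.map f hs) ≡ sumℤ d (λ j → multiplicity j hs ℤ.* + f j)
sum-by-multiplicity d f []       []            = sym (trans (sumℤ-cong d (λ j → ℤP.*-zeroˡ (+ f j))) (sumℤ-zero d))
  where
  sumℤ-zero : ∀ N → sumℤ N (λ _ → + 0) ≡ + 0
  sumℤ-zero zero    = refl
  sumℤ-zero (suc N) = cong (ℤ._+ + 0) (sumℤ-zero N)
sum-by-multiplicity d f (h ∷ hs) (h≤d ∷ hs≤d) = begin
  + (f h ℕ.+ ListSum.sum (List.map f hs))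
    ≡⟨ ℤP.pos-+ (f h) _ ⟩
  + f h ℤ.+ + ListSum.sum (List.map f hs)
    ≡⟨ cong₂ ℤ._+_ (sumℤ-indicator d (λ j → + f j) h≤d) (sym (sum-by-multiplicity d f hs hs≤d)) ⟨
  sumℤ d (λ j → indicator j h ℤ.* + f j) ℤ.+ sumℤ d (λ j → multiplicity j hs ℤ.* + f j)
    ≡⟨ sumℤ-+ d (λ j → indicator j h ℤ.* + f j) (λ j → multiplicity j hs ℤ.* + f j) ⟨
  sumℤ d (λ j → indicator j h ℤ.* + f j ℤ.+ multiplicity j hs ℤ.* + f j)
    ≡⟨ sumℤ-cong d (λ j → ℤP.*-distribʳ-+ (+ f j) (indicator j h) (multiplicity j hs)) ⟨
  sumℤ d (λ j → multiplicity j (h ∷ hs) ℤ.* + f j) ∎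
  where open ≡-Reasoning

record ScaledInverse {n} (W : Matrix n n) : Set where
  field
    inverse         : Matrix n n
    scale           : ℕ
    scale⁻¹         : ℚ
    scale*scale⁻¹   : ℤtoℚ (+ scale) ℚ.* scale⁻¹ ≡ 1ℚ
    isScaledInverse : IsScaledInverse W inverse (+ scale)

scaledInverse : ∀ {n} {W : Matrix n n} (A : Matrix n n) d .{{_ : ℕ.NonZero d}} →
  {_ : True (ℤtoℚ (+ d) ℚ.* (+ 1 ℚ./ d) ℚP.≟ 1ℚ)} → {_ : True (isScaledInverse? W A (+ d))} → ScaledInverse W
scaledInverse A d {d*d⁻¹≡1} {inverse-ok} = record
  { inverse         = A
  ; scale           = d
  ; scale⁻¹         = + 1 ℚ./ d
  ; scale*scale⁻¹   = toWitness d*d⁻¹≡1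
  ; isScaledInverse = toWitness inverse-ok
  }

simplex : ∀ {n} → (Fin (suc n) → Vec ℤ n) → LatticePolytope n
simplex {n} vs = record { k = n ; verts = vs }

-- Column i is (1, vᵢ): the cone over the simplex is the image of the nonnegative orthant.
homogeneousVertices : ∀ {n} → (Fin (suc n) → Vec ℤ n) → Matrix (suc n) (suc n)
homogeneousVertices vs zero    i = + 1
homogeneousVertices vs (suc c) i = lookup (vs i) c

homogenize : ∀ {A : Set} {n} → A → Vec A n → Fin (suc n) → A
homogenize q y zero    = q
homogenize q y (suc c) = lookup y c

relativeCoordinate : ∀ {n r} → (Fin (suc r) → Vec ℤ n) → Fin n → Fin (suc r) → ℚ
relativeCoordinate f c p = ℤtoℚ (lookup (f p) c ℤ.- lookup (f zero) c)

-- The coefficients expressing f p − f 0 in the coordinates of AffIndep.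
pointCoefficients : ∀ {r} → Fin (suc r) → Fin r → ℚ
pointCoefficients zero    t = 0ℚ
pointCoefficients (suc p) t = ℚMatrix.scalarMatrix 1ℚ p t

sum-pointCoefficients : ∀ {n r} (f : Fin (suc r) → Vec ℤ n) c p →
  ℚΣ.sum (λ t → pointCoefficients p t ℚ.* relativeCoordinate f c (suc t)) ≡ relativeCoordinate f c p
sum-pointCoefficients {r = r} f c zero = begin
  ℚΣ.sum {r} (λ t → 0ℚ ℚ.* relativeCoordinate f c (suc t))
    ≡⟨ ℚΣ.sum-cong-≗ (λ t → ℚP.*-zeroˡ (relativeCoordinate f c (suc t))) ⟩
  ℚΣ.sum {r} (λ _ → 0ℚ)
    ≡⟨ ℚΣ.sum-replicate-zero r ⟩
  0ℚ
    ≡⟨ cong ℤtoℚ (ℤP.+-inverseʳ (lookup (f zero) c)) ⟨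
  relativeCoordinate f c zero ∎
  where open ≡-Reasoning
sum-pointCoefficients f c (suc p) =
  trans (ℚΣ.sum-cong-≗ (λ t → ℚP.*-comm (pointCoefficients (suc p) t) _))
        (trans (ℚMatrix.scalarMatrix-⊙ 1ℚ (relativeCoordinate f c ∘ suc) p) (ℚP.*-identityʳ _))

repeated-point-dependent : ∀ {n r} (f : Fin (suc r) → Vec ℤ n) {i j} → i Fin.< j → f i ≡ f j → ¬ AffIndep f
repeated-point-dependent {r = r} f {i} {suc j} i<j fi≡fj independent =
  1≢0 (trans (sym cⱼ≡1) (independent c c-kills j))
  where
  c : Fin r → ℚ
  c t = pointCoefficients (suc j) t ℚ.- pointCoefficients i t
  c-kills : ∀ coord → sumℚ (λ t → c t ℚ.* relativeCoordinate f coord (suc t)) ≡ 0ℚ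
  c-kills coord = begin
    sumℚ (λ t → c t ℚ.* g t)
      ≡⟨ sumℚ≡sum (λ t → c t ℚ.* g t) ⟩
    ℚΣ.sum (λ t → c t ℚ.* g t)
      ≡⟨ ℚΣ.sum-cong-≗ (λ t → solve 3 (λ a b x → (a :- b) :* x := a :* x :+ (:- con 1ℚ) :* (b :* x)) refl
                                       (pointCoefficients (suc j) t) (pointCoefficients i t) (g t)) ⟩
    ℚΣ.sum (λ t → e (suc j) t ℚ.+ ℚ.- 1ℚ ℚ.* e i t)
      ≡⟨ ℚΣ.∑-distrib-+ (e (suc j)) (λ t → ℚ.- 1ℚ ℚ.* e i t) ⟩
    ℚΣ.sum (e (suc j)) ℚ.+ ℚΣ.sum (λ t → ℚ.- 1ℚ ℚ.* e i t)
      ≡⟨ cong (ℚΣ.sum (e (suc j)) ℚ.+_) (ℚΣ.*-distribˡ-sum (ℚ.- 1ℚ) (e i)) ⟨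
    ℚΣ.sum (e (suc j)) ℚ.+ ℚ.- 1ℚ ℚ.* ℚΣ.sum (e i)
      ≡⟨ cong₂ (λ a b → a ℚ.+ ℚ.- 1ℚ ℚ.* b) (sum-pointCoefficients f coord (suc j)) (sum-pointCoefficients f coord i) ⟩
    relativeCoordinate f coord (suc j) ℚ.+ ℚ.- 1ℚ ℚ.* relativeCoordinate f coord i
      ≡⟨ cong (λ v → ℤtoℚ (lookup v coord ℤ.- lookup (f zero) coord) ℚ.+ ℚ.- 1ℚ ℚ.* relativeCoordinate f coord i)
              fi≡fj ⟨
    relativeCoordinate f coord i ℚ.+ ℚ.- 1ℚ ℚ.* relativeCoordinate f coord i
      ≡⟨ solve 1 (λ a → a :+ (:- con 1ℚ) :* a := con 0ℚ) refl (relativeCoordinate f coord i) ⟩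
    0ℚ ∎
    where
    open ≡-Reasoning
    g : Fin r → ℚ
    g = relativeCoordinate f coord ∘ suc
    e : Fin (suc r) → Fin r → ℚ
    e p t = pointCoefficients p t ℚ.* g t
  cⱼ≡1 : c j ≡ 1ℚ
  cⱼ≡1 = cong₂ ℚ._-_ (ℚMatrix.scalarMatrix-diagonal 1ℚ j) (not-j i<j)
    where
    not-j : ∀ {k} → k Fin.< suc j → pointCoefficients k j ≡ 0ℚ
    not-j {zero}  _   = refl
    not-j {suc k} k<j = ℚMatrix.scalarMatrix-offDiagonal 1ℚ (λ k≡j → ℕP.<-irrefl (cong Fin.toℕ k≡j) (ℕP.≤-pred k<j))
  1≢0 : 1ℚ ≢ 0ℚ
  1≢0 ()

module LatticeSimplex {n} (vs : Fin (suc n) → Vec ℤ n) (inv : ScaledInverse (homogeneousVertices vs)) where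

  open ScaledInverse inv
  open ℚMatrix using () renaming (_⊙_ to _⊙ℚ_)

  Wℚ Aℚ : ℚMatrix.Matrix (suc n) (suc n)
  Wℚ = toℚMatrix (homogeneousVertices vs)
  Aℚ = toℚMatrix inverse

  scaleℚ : ℚ
  scaleℚ = ℤtoℚ (+ scale)

  scale⁻¹-nonNeg : 0ℚ ℚ.≤ scale⁻¹
  scale⁻¹-nonNeg = inverse-nonNeg (ℕtoℚ-nonNeg scale) scale*scale⁻¹

  invℚ : ℚMatrix.IsScaledInverse Wℚ Aℚ scaleℚ
  invℚ = toℚ-isScaledInverse isScaledInverse

  InDilate-fields⇔ : ∀ q y (lam : Fin (suc n) → ℚ) →
    (sumℚ lam ≡ q × (∀ c → sumℚ (λ i → lam i ℚ.* ℤtoℚ (lookup (vs i) c)) ≡ lookup y c)) ⇔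
    (∀ j → (Wℚ ⊙ℚ lam) j ≡ homogenize q y j)
  InDilate-fields⇔ q y lam = mk⇔
    (λ (Σlam≡q , coords) → λ { zero    → trans (sum-*1 lam) Σlam≡q
                             ; (suc c) → trans (sym (sumℚ≡sum (weighted c))) (coords c) })
    (λ W⊙lam≡z → trans (sym (sum-*1 lam)) (W⊙lam≡z zero) ,
                 λ c → trans (sumℚ≡sum (weighted c)) (W⊙lam≡z (suc c)))
    where
    weighted : Fin n → Fin (suc n) → ℚ
    weighted c i = lam i ℚ.* ℤtoℚ (lookup (vs i) c)
    sum-*1 : ∀ (f : Fin (suc n) → ℚ) → ℚΣ.sum (λ i → f i ℚ.* ℤtoℚ (+ 1)) ≡ sumℚ f
    sum-*1 f = trans (ℚΣ.sum-cong-≗ (λ i → ℚP.*-identityʳ (f i))) (sym (sumℚ≡sum f))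

  InDilate⇒inverse-nonNeg : ∀ q y → InDilate (simplex vs) q y → ∀ i → 0ℚ ℚ.≤ (Aℚ ⊙ℚ homogenize q y) i
  InDilate⇒inverse-nonNeg q y (lam , lam≥0 , Σlam≡q , coords) i = begin
    0ℚ                        ≤⟨ *-nonNeg (lam≥0 i) (ℕtoℚ-nonNeg scale) ⟩
    lam i ℚ.* scaleℚ          ≡⟨ ℚMatrix.scaledInverse-⊙ˡ invℚ lam i ⟨
    (Aℚ ⊙ℚ (Wℚ ⊙ℚ lam)) i     ≡⟨ ℚMatrix.⊙-congʳ Aℚ W⊙lam≡z i ⟩
    (Aℚ ⊙ℚ homogenize q y) i  ∎
    where
    open ℚP.≤-Reasoning
    W⊙lam≡z : ∀ j → (Wℚ ⊙ℚ lam) j ≡ homogenize q y j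
    W⊙lam≡z = Equivalence.to (InDilate-fields⇔ q y lam) (Σlam≡q , coords)

  inverse-nonNeg⇒InDilate : ∀ q y → (∀ i → 0ℚ ℚ.≤ (Aℚ ⊙ℚ homogenize q y) i) → InDilate (simplex vs) q y
  inverse-nonNeg⇒InDilate q y A⊙z≥0 =
    lam , (λ i → *-nonNeg (A⊙z≥0 i) scale⁻¹-nonNeg) , Equivalence.from (InDilate-fields⇔ q y lam) W⊙lam≡z
    where
    z : Fin (suc n) → ℚ
    z = homogenize q y
    lam : Fin (suc n) → ℚ
    lam i = (Aℚ ⊙ℚ z) i ℚ.* scale⁻¹
    W⊙lam≡z : ∀ j → (Wℚ ⊙ℚ lam) j ≡ z j
    W⊙lam≡z j = begin
      (Wℚ ⊙ℚ lam) j                   ≡⟨ ℚMatrix.⊙-*ʳ Wℚ (Aℚ ⊙ℚ z) scale⁻¹ j ⟩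
      (Wℚ ⊙ℚ (Aℚ ⊙ℚ z)) j ℚ.* scale⁻¹ ≡⟨ cong (ℚ._* scale⁻¹) (ℚMatrix.scaledInverse-⊙ʳ invℚ z j) ⟩
      z j ℚ.* scaleℚ ℚ.* scale⁻¹      ≡⟨ ℚP.*-assoc (z j) scaleℚ scale⁻¹ ⟩
      z j ℚ.* (scaleℚ ℚ.* scale⁻¹)    ≡⟨ cong (z j ℚ.*_) scale*scale⁻¹ ⟩
      z j ℚ.* 1ℚ                      ≡⟨ ℚP.*-identityʳ (z j) ⟩
      z j                             ∎
      where open ≡-Reasoning

  instance
    scale-nonZero : ℕ.NonZero scale
    scale-nonZero = inverse-nonZero scale scale*scale⁻¹

    scale-positive : ℤ.Positive (+ scale)
    scale-positive = ℤ.positive (ℤ.+<+ (ℕ.>-nonZero⁻¹ scale))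

  latticePoint⇔ : ∀ m x → InDilate (simplex vs) (ℕtoℚ m) (Vec.map ℤtoℚ x) ⇔
                          (∀ i → + 0 ℤ.≤ (inverse ⊙ homogenize (+ m) x) i)
  latticePoint⇔ m x = mk⇔
    (λ x∈mP i → ℤtoℚ-cancel-≤ (subst (0ℚ ℚ.≤_) (A⊙z≡ℤtoℚ i) (InDilate⇒inverse-nonNeg (ℕtoℚ m) y x∈mP i)))
    (λ A⊙z≥0 → inverse-nonNeg⇒InDilate (ℕtoℚ m) y λ i →
       subst (0ℚ ℚ.≤_) (sym (A⊙z≡ℤtoℚ i)) (ℤtoℚ-mono-≤ (A⊙z≥0 i)))
    where
    y : Vec ℚ n
    y = Vec.map ℤtoℚ x
    homogenize-ℤtoℚ : ∀ j → homogenize (ℕtoℚ m) y j ≡ ℤtoℚ (homogenize (+ m) x j)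
    homogenize-ℤtoℚ zero    = refl
    homogenize-ℤtoℚ (suc c) = VecP.lookup-map c ℤtoℚ x
    A⊙z≡ℤtoℚ : ∀ i → (Aℚ ⊙ℚ homogenize (ℕtoℚ m) y) i ≡ ℤtoℚ ((inverse ⊙ homogenize (+ m) x) i)
    A⊙z≡ℤtoℚ i = trans (ℚMatrix.⊙-congʳ Aℚ homogenize-ℤtoℚ i)
                       (sym (ℤtoℚ-⊙ inverse (homogenize (+ m) x) i))

  W : Matrix (suc n) (suc n)
  W = homogeneousVertices vs

  conePoint : Vec ℤ (suc n) → Vec ℕ (suc n) → Fin (suc n) → ℤ
  conePoint b κ j = lookup b j ℤ.+ (W ⊙ (+_ ∘ lookup κ)) j

  boxCoordinates : Vec ℤ (suc n) → Fin (suc n) → ℤ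
  boxCoordinates b = inverse ⊙ lookup b

  -- b lies in the half-open parallelepiped spanned by the columns of W.
  InBox : Vec ℤ (suc n) → Set
  InBox b = ∀ i → + 0 ℤ.≤ boxCoordinates b i × boxCoordinates b i ℤ.< + scale

  W⊙boxCoordinates : ∀ b j → (W ⊙ boxCoordinates b) j ≡ lookup b j ℤ.* + scale
  W⊙boxCoordinates b = ℤMatrix.scaledInverse-⊙ʳ isScaledInverse (lookup b)

  inverse-conePoint : ∀ b κ i →
    (inverse ⊙ conePoint b κ) i ≡ boxCoordinates b i ℤ.+ + lookup κ i ℤ.* + scale
  inverse-conePoint b κ i =
    trans (ℤMatrix.⊙-+ inverse (lookup b) (W ⊙ (+_ ∘ lookup κ)) i)
          (cong (λ t → boxCoordinates b i ℤ.+ t) (ℤMatrix.scaledInverse-⊙ˡ isScaledInverse (+_ ∘ lookup κ) i))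

  inverse-conePoint-ℕ : ∀ b κ → InBox b → ∀ i →
    (inverse ⊙ conePoint b κ) i ≡ + (ℤ.∣ boxCoordinates b i ∣ ℕ.+ lookup κ i ℕ.* scale)
  inverse-conePoint-ℕ b κ b∈ i = begin
    (inverse ⊙ conePoint b κ) i
      ≡⟨ inverse-conePoint b κ i ⟩
    boxCoordinates b i ℤ.+ + lookup κ i ℤ.* + scale
      ≡⟨ cong₂ ℤ._+_ (ℤP.0≤i⇒+∣i∣≡i (proj₁ (b∈ i))) (ℤP.pos-* (lookup κ i) scale) ⟨
    + ℤ.∣ boxCoordinates b i ∣ ℤ.+ + (lookup κ i ℕ.* scale)
      ≡⟨ ℤP.pos-+ (ℤ.∣ boxCoordinates b i ∣) _ ⟨
    + (ℤ.∣ boxCoordinates b i ∣ ℕ.+ lookup κ i ℕ.* scale) ∎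
    where open ≡-Reasoning

  box-remainder : ∀ b → InBox b → ∀ i → ℤ.∣ boxCoordinates b i ∣ ℕ.< scale
  box-remainder b b∈ i with boxCoordinates b i | b∈ i
  ... | + r | _ , ℤ.+<+ r<scale = r<scale

  conePoint-injective : ∀ {b b′ κ κ′} → InBox b → InBox b′ →
                        (∀ j → conePoint b κ j ≡ conePoint b′ κ′ j) → b ≡ b′ × κ ≡ κ′
  conePoint-injective {b} {b′} {κ} {κ′} b∈ b′∈ same = lookup-ext b≗b′ , lookup-ext (proj₂ ∘ decoded)
    where
    open ≡-Reasoning
    decoded : ∀ i → ℤ.∣ boxCoordinates b i ∣ ≡ ℤ.∣ boxCoordinates b′ i ∣ × lookup κ i ≡ lookup κ′ i
    decoded i = divMod-injective (box-remainder b b∈ i) (box-remainder b′ b′∈ i) (ℤP.+-injective (begin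
      + (ℤ.∣ boxCoordinates b i ∣ ℕ.+ lookup κ i ℕ.* scale)     ≡⟨ inverse-conePoint-ℕ b κ b∈ i ⟨
      (inverse ⊙ conePoint b κ) i                             ≡⟨ ℤMatrix.⊙-congʳ inverse same i ⟩
      (inverse ⊙ conePoint b′ κ′) i                           ≡⟨ inverse-conePoint-ℕ b′ κ′ b′∈ i ⟩
      + (ℤ.∣ boxCoordinates b′ i ∣ ℕ.+ lookup κ′ i ℕ.* scale)   ∎))
    box≗box′ : ∀ i → boxCoordinates b i ≡ boxCoordinates b′ i
    box≗box′ i = begin
      boxCoordinates b i            ≡⟨ ℤP.0≤i⇒+∣i∣≡i (proj₁ (b∈ i)) ⟨
      + ℤ.∣ boxCoordinates b i ∣    ≡⟨ cong +_ (proj₁ (decoded i)) ⟩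
      + ℤ.∣ boxCoordinates b′ i ∣   ≡⟨ ℤP.0≤i⇒+∣i∣≡i (proj₁ (b′∈ i)) ⟩
      boxCoordinates b′ i           ∎
    b≗b′ : ∀ j → lookup b j ≡ lookup b′ j
    b≗b′ j = ℤP.*-cancelʳ-≡ _ _ (+ scale) (begin
      lookup b j ℤ.* + scale     ≡⟨ W⊙boxCoordinates b j ⟨
      (W ⊙ boxCoordinates b) j   ≡⟨ ℤMatrix.⊙-congʳ W box≗box′ j ⟩
      (W ⊙ boxCoordinates b′) j  ≡⟨ W⊙boxCoordinates b′ j ⟩
      lookup b′ j ℤ.* + scale    ∎)

  Decomposition : (Fin (suc n) → ℤ) → Set
  Decomposition z = Σ (Vec ℤ (suc n)) λ b → Σ (Vec ℕ (suc n)) λ κ → InBox b × (∀ j → conePoint b κ j ≡ z j)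

  decompose : ∀ z → (∀ i → + 0 ℤ.≤ (inverse ⊙ z) i) → Decomposition z
  decompose z A⊙z≥0 = b , κ , b∈ , b+Wκ≡z
    where
    α : Fin (suc n) → ℕ
    α i = ℤ.∣ (inverse ⊙ z) i ∣
    κ : Vec ℕ (suc n)
    κ = Vec.tabulate (λ i → α i / scale)
    Wκ : Fin (suc n) → ℤ
    Wκ = W ⊙ (+_ ∘ lookup κ)
    b : Vec ℤ (suc n)
    b = Vec.tabulate (λ j → z j ℤ.- Wκ j)
    b+Wκ≡z : ∀ j → conePoint b κ j ≡ z j
    b+Wκ≡z j = trans (cong (ℤ._+ Wκ j) (VecP.lookup∘tabulate (λ j → z j ℤ.- Wκ j) j))
                     (ℤ+Group.//-rightDividesˡ (Wκ j) (z j))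
    box≡remainder : ∀ i → boxCoordinates b i ≡ + (α i % scale)
    box≡remainder i = ℤ+Group.∙-cancelʳ (+ lookup κ i ℤ.* + scale) _ _ (begin
      boxCoordinates b i ℤ.+ + lookup κ i ℤ.* + scale  ≡⟨ inverse-conePoint b κ i ⟨
      (inverse ⊙ conePoint b κ) i                      ≡⟨ ℤMatrix.⊙-congʳ inverse b+Wκ≡z i ⟩
      (inverse ⊙ z) i                                  ≡⟨ ℤP.0≤i⇒+∣i∣≡i (A⊙z≥0 i) ⟨
      + α i                                            ≡⟨ cong +_ (m≡m%n+[m/n]*n (α i) scale) ⟩
      + (α i % scale ℕ.+ α i / scale ℕ.* scale)        ≡⟨ ℤP.pos-+ (α i % scale) _ ⟩
      + (α i % scale) ℤ.+ + (α i / scale ℕ.* scale)    ≡⟨ cong (λ t → + (α i % scale) ℤ.+ t) quotient ⟩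
      + (α i % scale) ℤ.+ + lookup κ i ℤ.* + scale     ∎)
      where
      open ≡-Reasoning
      quotient : + (α i / scale ℕ.* scale) ≡ + lookup κ i ℤ.* + scale
      quotient = trans (ℤP.pos-* (α i / scale) scale)
                       (cong (λ t → + t ℤ.* + scale) (sym (VecP.lookup∘tabulate (λ i → α i / scale) i)))
    b∈ : InBox b
    b∈ i = subst (+ 0 ℤ.≤_) (sym (box≡remainder i)) (ℤ.+≤+ ℕ.z≤n) ,
           subst (ℤ._< + scale) (sym (box≡remainder i)) (ℤ.+<+ (m%n<n (α i) scale))

  height : Vec ℤ (suc n) → ℕ
  height b = ℤ.∣ lookup b zero ∣

  W⊙-row₀ : ∀ x → (W ⊙ x) zero ≡ ℤΣ.sum x
  W⊙-row₀ x = ℤΣ.sum-cong-≗ (λ k → ℤP.*-identityʳ (x k))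

  box-height : ∀ b → lookup b zero ℤ.* + scale ≡ ℤΣ.sum (boxCoordinates b)
  box-height b = trans (sym (W⊙boxCoordinates b zero)) (W⊙-row₀ (boxCoordinates b))

  box-height-nonNeg : ∀ b → InBox b → + 0 ℤ.≤ lookup b zero
  box-height-nonNeg b b∈ = ℤP.*-cancelʳ-≤-pos (+ 0) (lookup b zero) (+ scale)
    (subst (+ 0 ℤ.≤_) (sym (box-height b)) (sumℤ-nonNeg (proj₁ ∘ b∈)))

  -- scale · b₀ is the sum of the n + 1 box coordinates, each of which is below scale.
  height-≤ : ∀ b → InBox b → height b ℕ.≤ n
  height-≤ b b∈ =
    ℕP.≤-pred (ℤP.drop‿+<+ (subst (ℤ._< + suc n) (sym (ℤP.0≤i⇒+∣i∣≡i (box-height-nonNeg b b∈))) b₀<1+n))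
    where
    b₀<1+n : lookup b zero ℤ.< + suc n
    b₀<1+n = ℤP.*-cancelʳ-<-nonNeg (+ scale) (begin-strict
      lookup b zero ℤ.* + scale        ≡⟨ box-height b ⟩
      ℤΣ.sum (boxCoordinates b)        <⟨ sumℤ-mono-< (proj₂ ∘ b∈) ⟩
      ℤΣ.sum {suc n} (λ _ → + scale)   ≡⟨ sumℤ-const (suc n) (+ scale) ⟩
      + suc n ℤ.* + scale              ∎)
      where open ℤP.≤-Reasoning

  conePoint-height : ∀ b κ → InBox b → conePoint b κ zero ≡ + (height b ℕ.+ Vec.sum κ)
  conePoint-height b κ b∈ = begin
    lookup b zero ℤ.+ (W ⊙ (+_ ∘ lookup κ)) zero
      ≡⟨ cong₂ ℤ._+_ (ℤP.0≤i⇒+∣i∣≡i (box-height-nonNeg b b∈)) (sym (trans (W⊙-row₀ (+_ ∘ lookup κ)) (sumℤ-pos κ))) ⟨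
    + height b ℤ.+ + Vec.sum κ
      ≡⟨ ℤP.pos-+ (height b) (Vec.sum κ) ⟨
    + (height b ℕ.+ Vec.sum κ) ∎
    where open ≡-Reasoning

  lowerBound upperBound : Fin (suc n) → ℤ
  lowerBound j = ℤΣ.sum (λ k → negativePart (W j k))
  upperBound j = ℤΣ.sum (λ k → positivePart (W j k))

  box-bounded : ∀ b → InBox b → ∀ j → lowerBound j ℤ.≤ lookup b j × lookup b j ℤ.≤ upperBound j
  box-bounded b b∈ j = ℤP.*-cancelʳ-≤-pos _ _ (+ scale) lower , ℤP.*-cancelʳ-≤-pos _ _ (+ scale) upper
    where
    open ℤP.≤-Reasoning
    r≤scale : ∀ k → boxCoordinates b k ℤ.≤ + scale
    r≤scale k = ℤP.<⇒≤ (proj₂ (b∈ k))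
    lower : lowerBound j ℤ.* + scale ℤ.≤ lookup b j ℤ.* + scale
    lower = begin
      lowerBound j ℤ.* + scale                         ≡⟨ ℤP.*-comm (lowerBound j) (+ scale) ⟩
      + scale ℤ.* lowerBound j                         ≡⟨ ℤΣ.*-distribˡ-sum (+ scale) (λ k → negativePart (W j k)) ⟩
      ℤΣ.sum (λ k → + scale ℤ.* negativePart (W j k))  ≤⟨ sumℤ-mono-≤ (λ k → *-≥-negativePart (W j k) (proj₁ (b∈ k)) (r≤scale k)) ⟩
      (W ⊙ boxCoordinates b) j                         ≡⟨ W⊙boxCoordinates b j ⟩
      lookup b j ℤ.* + scale                           ∎
    upper : lookup b j ℤ.* + scale ℤ.≤ upperBound j ℤ.* + scale
    upper = begin
      lookup b j ℤ.* + scale                           ≡⟨ W⊙boxCoordinates b j ⟨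
      (W ⊙ boxCoordinates b) j                         ≤⟨ sumℤ-mono-≤ (λ k → *-≤-positivePart (W j k) (proj₁ (b∈ k)) (r≤scale k)) ⟩
      ℤΣ.sum (λ k → + scale ℤ.* positivePart (W j k))  ≡⟨ ℤΣ.*-distribˡ-sum (+ scale) (λ k → positivePart (W j k)) ⟨
      + scale ℤ.* upperBound j                         ≡⟨ ℤP.*-comm (+ scale) (upperBound j) ⟩
      upperBound j ℤ.* + scale                         ∎

  InBox? : ∀ b → Dec (InBox b)
  InBox? b = FinP.all? (λ i → (+ 0 ℤ.≤? boxCoordinates b i) ×-dec (boxCoordinates b i ℤ.<? + scale))

  boxPoints : List (Vec ℤ (suc n))
  boxPoints = List.filter InBox? (grid lowerBound upperBound)

  ∈-boxPoints⁺ : ∀ b → InBox b → b ∈ boxPoints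
  ∈-boxPoints⁺ b b∈ = MembershipP.∈-filter⁺ InBox? (∈-grid b (box-bounded b b∈)) b∈

  ∈-boxPoints⁻ : ∀ b → b ∈ boxPoints → InBox b
  ∈-boxPoints⁻ b b∈ = proj₂ (MembershipP.∈-filter⁻ InBox? {xs = grid lowerBound upperBound} b∈)

  boxPoints-unique : Unique boxPoints
  boxPoints-unique = UniqueP.filter⁺ InBox? (grid-unique lowerBound upperBound)

  dehomogenize : (Fin (suc n) → ℤ) → Vec ℤ n
  dehomogenize z = Vec.tabulate (z ∘ suc)

  latticePointsOver : ℕ → Vec ℤ (suc n) → List (Vec ℤ n)
  latticePointsOver m b = List.map (dehomogenize ∘ conePoint b) (compositionsAbove n (height b) m)

  latticePoints : ℕ → List (Vec ℤ n)
  latticePoints m = List.concatMap (latticePointsOver m) boxPoints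

  homogenize-dehomogenize : ∀ m b κ → InBox b → Vec.sum κ ℕ.+ height b ≡ m →
                            ∀ j → homogenize (+ m) (dehomogenize (conePoint b κ)) j ≡ conePoint b κ j
  homogenize-dehomogenize m b κ b∈ Σκ+h≡m zero =
    sym (trans (conePoint-height b κ b∈) (cong +_ (trans (ℕP.+-comm (height b) (Vec.sum κ)) Σκ+h≡m)))
  homogenize-dehomogenize m b κ b∈ Σκ+h≡m (suc c) = VecP.lookup∘tabulate (conePoint b κ ∘ suc) c

  conePoint-over : ∀ {m b x} → b ∈ boxPoints → x ∈ latticePointsOver m b →
    Σ (Vec ℕ (suc n)) λ κ → Vec.sum κ ℕ.+ height b ≡ m × (∀ j → homogenize (+ m) x j ≡ conePoint b κ j)
  conePoint-over {m} {b} b∈ x∈ with MembershipP.∈-map⁻ (dehomogenize ∘ conePoint b) x∈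
  ... | κ , κ∈ , refl = κ , Σκ+h≡m , homogenize-dehomogenize m b κ (∈-boxPoints⁻ b b∈) Σκ+h≡m
    where
    Σκ+h≡m : Vec.sum κ ℕ.+ height b ≡ m
    Σκ+h≡m = ∈-compositionsAbove⁻ n (height b) m κ κ∈

  ∈-latticePoints⁻ : ∀ m x → x ∈ latticePoints m → InDilate (simplex vs) (ℕtoℚ m) (Vec.map ℤtoℚ x)
  ∈-latticePoints⁻ m x x∈ with find (MembershipP.∈-concatMap⁻ (latticePointsOver m) {xs = boxPoints} x∈)
  ... | b , b∈ , x∈b with conePoint-over b∈ x∈b
  ...   | κ , _ , x≗b+Wκ = Equivalence.from (latticePoint⇔ m x) λ i →
    subst (+ 0 ℤ.≤_) (sym (trans (ℤMatrix.⊙-congʳ inverse x≗b+Wκ i) (inverse-conePoint-ℕ b κ (∈-boxPoints⁻ b b∈) i)))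
          (ℤ.+≤+ ℕ.z≤n)

  ∈-latticePoints⁺ : ∀ m x → InDilate (simplex vs) (ℕtoℚ m) (Vec.map ℤtoℚ x) → x ∈ latticePoints m
  ∈-latticePoints⁺ m x x∈mP =
    from-decomposition (decompose (homogenize (+ m) x) (Equivalence.to (latticePoint⇔ m x) x∈mP))
    where
    from-decomposition : Decomposition (homogenize (+ m) x) → x ∈ latticePoints m
    from-decomposition (b , κ , b∈ , b+Wκ≡z) =
      MembershipP.∈-concatMap⁺ (latticePointsOver m) {xs = boxPoints} (lose (∈-boxPoints⁺ b b∈)
        (subst (_∈ latticePointsOver m b) x′≡x (MembershipP.∈-map⁺ (dehomogenize ∘ conePoint b)
          (∈-compositionsAbove⁺ n (height b) m κ Σκ+h≡m))))
      where
      Σκ+h≡m : Vec.sum κ ℕ.+ height b ≡ m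
      Σκ+h≡m = trans (ℕP.+-comm (Vec.sum κ) (height b))
                     (ℤP.+-injective (trans (sym (conePoint-height b κ b∈)) (b+Wκ≡z zero)))
      x′≡x : dehomogenize (conePoint b κ) ≡ x
      x′≡x = lookup-ext (λ c → trans (VecP.lookup∘tabulate (conePoint b κ ∘ suc) c) (b+Wκ≡z (suc c)))

  latticePoints-unique : ∀ m → Unique (latticePoints m)
  latticePoints-unique m = concatMap-unique (latticePointsOver m) boxPoints-unique over-unique over-disjoint
    where
    over-unique : ∀ {b} → b ∈ boxPoints → Unique (latticePointsOver m b)
    over-unique {b} b∈ = map-unique (dehomogenize ∘ conePoint b) (compositionsAbove-unique n (height b) m)
      λ {κ} {κ′} κ∈ κ′∈ same → proj₂ (conePoint-injective {b} {b} {κ} {κ′} b∈Box b∈Box λ j →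
        trans (sym (restore κ κ∈ j)) (trans (cong (λ x → homogenize (+ m) x j) same) (restore κ′ κ′∈ j)))
      where
      b∈Box : InBox b
      b∈Box = ∈-boxPoints⁻ b b∈
      restore : ∀ κ → κ ∈ compositionsAbove n (height b) m →
                ∀ j → homogenize (+ m) (dehomogenize (conePoint b κ)) j ≡ conePoint b κ j
      restore κ κ∈ = homogenize-dehomogenize m b κ b∈Box (∈-compositionsAbove⁻ n (height b) m κ κ∈)
    over-disjoint : ∀ {b b′ x} → b ∈ boxPoints → b′ ∈ boxPoints →
                    x ∈ latticePointsOver m b → x ∈ latticePointsOver m b′ → b ≡ b′
    over-disjoint {b} {b′} b∈ b′∈ x∈ x∈′ with conePoint-over b∈ x∈ | conePoint-over b′∈ x∈′
    ... | κ , _ , x≗b+Wκ | κ′ , _ , x≗b′+Wκ′ =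
      proj₁ (conePoint-injective {b} {b′} {κ} {κ′} (∈-boxPoints⁻ b b∈) (∈-boxPoints⁻ b′ b′∈)
                                 (λ j → trans (sym (x≗b+Wκ j)) (x≗b′+Wκ′ j)))

  length-latticePoints : ∀ m →
    length (latticePoints m) ≡ ListSum.sum (List.map (λ b → negBinom n (height b) m) boxPoints)
  length-latticePoints m = trans (length-concatMap (latticePointsOver m) boxPoints)
    (cong ListSum.sum (ListP.map-cong (λ b → trans (ListP.length-map _ (compositionsAbove n (height b) m))
                                                    (length-compositionsAbove n (height b) m)) boxPoints))

  ehrhartCount : ∀ m → EhrhartCount (simplex vs) m (length (latticePoints m))
  ehrhartCount m = latticePoints m , latticePoints-unique m , refl ,
                   λ x → ∈-latticePoints⁻ m x , ∈-latticePoints⁺ m x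

  scale-cancel : ∀ q → q ℚ.* scaleℚ ≡ 0ℚ → q ≡ 0ℚ
  scale-cancel q qD≡0 = begin
    q                          ≡⟨ ℚP.*-identityʳ q ⟨
    q ℚ.* 1ℚ                   ≡⟨ cong (q ℚ.*_) scale*scale⁻¹ ⟨
    q ℚ.* (scaleℚ ℚ.* scale⁻¹) ≡⟨ ℚP.*-assoc q scaleℚ scale⁻¹ ⟨
    q ℚ.* scaleℚ ℚ.* scale⁻¹   ≡⟨ cong (ℚ._* scale⁻¹) qD≡0 ⟩
    0ℚ ℚ.* scale⁻¹             ≡⟨ ℚP.*-zeroˡ scale⁻¹ ⟩
    0ℚ                         ∎
    where open ≡-Reasoning

  vertices-independent : AffIndep vs
  vertices-independent c c-kills i = scale-cancel (c i) (begin
    x (suc i) ℚ.* scaleℚ          ≡⟨ ℚMatrix.scaledInverse-⊙ˡ invℚ x (suc i) ⟨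
    (Aℚ ⊙ℚ (Wℚ ⊙ℚ x)) (suc i)     ≡⟨ ℚMatrix.⊙-congʳ Aℚ W⊙x≡0 (suc i) ⟩
    (Aℚ ⊙ℚ (λ _ → 0ℚ)) (suc i)    ≡⟨ ℚMatrix.⊙-zero Aℚ (suc i) ⟩
    0ℚ                            ∎)
    where
    open ≡-Reasoning
    -- The affine dependence c becomes a linear dependence of the columns of W.
    x : Fin (suc n) → ℚ
    x zero    = ℚ.- sumℚ c
    x (suc i) = c i
    W⊙x≡0 : ∀ j → (Wℚ ⊙ℚ x) j ≡ 0ℚ
    W⊙x≡0 zero = begin
      x zero ℚ.* ℤtoℚ (+ 1) ℚ.+ ℚΣ.sum (λ i → c i ℚ.* ℤtoℚ (+ 1))
        ≡⟨ cong₂ ℚ._+_ (ℚP.*-identityʳ (x zero))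
                       (trans (ℚΣ.sum-cong-≗ (λ i → ℚP.*-identityʳ (c i))) (sym (sumℚ≡sum c))) ⟩
      ℚ.- sumℚ c ℚ.+ sumℚ c  ≡⟨ ℚP.+-inverseˡ (sumℚ c) ⟩
      0ℚ                     ∎
    W⊙x≡0 (suc coord) = begin
      x zero ℚ.* q ℚ.+ ℚΣ.sum (λ i → c i ℚ.* p i)
        ≡⟨ cong (x zero ℚ.* q ℚ.+_)
                (ℚΣ.sum-cong-≗ (λ i → solve 3 (λ c p q → c :* p := c :* (p :- q) :+ c :* q) refl (c i) (p i) q)) ⟩
      x zero ℚ.* q ℚ.+ ℚΣ.sum (λ i → c i ℚ.* (p i ℚ.- q) ℚ.+ c i ℚ.* q)
        ≡⟨ cong (x zero ℚ.* q ℚ.+_) (ℚΣ.∑-distrib-+ (λ i → c i ℚ.* (p i ℚ.- q)) (λ i → c i ℚ.* q)) ⟩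
      x zero ℚ.* q ℚ.+ (ℚΣ.sum (λ i → c i ℚ.* (p i ℚ.- q)) ℚ.+ ℚΣ.sum (λ i → c i ℚ.* q))
        ≡⟨ cong₂ (λ a b → x zero ℚ.* q ℚ.+ (a ℚ.+ b)) dependence (sym (ℚΣ.*-distribʳ-sum q c)) ⟩
      ℚ.- sumℚ c ℚ.* q ℚ.+ (0ℚ ℚ.+ ℚΣ.sum c ℚ.* q)
        ≡⟨ cong (λ s → ℚ.- sumℚ c ℚ.* q ℚ.+ (0ℚ ℚ.+ s ℚ.* q)) (sumℚ≡sum c) ⟨
      ℚ.- sumℚ c ℚ.* q ℚ.+ (0ℚ ℚ.+ sumℚ c ℚ.* q)
        ≡⟨ solve 2 (λ s q → (:- s) :* q :+ (con 0ℚ :+ s :* q) := con 0ℚ) refl (sumℚ c) q ⟩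
      0ℚ ∎
      where
      p : Fin n → ℚ
      p i = ℤtoℚ (lookup (vs (suc i)) coord)
      q : ℚ
      q = ℤtoℚ (lookup (vs zero) coord)
      dependence : ℚΣ.sum (λ i → c i ℚ.* (p i ℚ.- q)) ≡ 0ℚ
      dependence = trans (ℚΣ.sum-cong-≗ (λ i → cong (c i ℚ.*_) (sym (ℤtoℚ-- (lookup (vs (suc i)) coord) (lookup (vs zero) coord)))))
                         (trans (sym (sumℚ≡sum (λ i → c i ℚ.* relativeCoordinate vs coord (suc i)))) (c-kills coord))

  dimension : Dim (simplex vs) n
  dimension = ((λ i → i) , vertices-independent) , λ idx →
    let (i , j , i<j , idxᵢ≡idxⱼ) = FinP.pigeonhole (ℕP.n<1+n (suc n)) idx
    in  repeated-point-dependent (vs ∘ idx) i<j (cong vs idxᵢ≡idxⱼ)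

  boxHeights : List ℕ
  boxHeights = List.map height boxPoints

  hStar : ∀ h → length h ≡ suc n → (∀ j → coeff h j ≡ multiplicity j boxHeights) → HStar (simplex vs) h
  hStar h length≡ coeff≡ = n , dimension , length≡ , λ m → length (latticePoints m) , ehrhartCount m , (begin
    + length (latticePoints m)
      ≡⟨ cong +_ (length-latticePoints m) ⟩
    + ListSum.sum (List.map (λ b → negBinom n (height b) m) boxPoints)
      ≡⟨ cong (+_ ∘ ListSum.sum) (ListP.map-∘ boxPoints) ⟩
    + ListSum.sum (List.map (λ j → negBinom n j m) boxHeights)
      ≡⟨ sum-by-multiplicity n (λ j → negBinom n j m) boxHeights heights-≤ ⟩
    sumℤ n (λ j → multiplicity j boxHeights ℤ.* + negBinom n j m)
      ≡⟨ sumℤ-cong n (λ j → cong (ℤ._* + negBinom n j m) (coeff≡ j)) ⟨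
    sumℤ n (λ j → coeff h j ℤ.* + negBinom n j m) ∎)
    where
    open ≡-Reasoning
    heights-≤ : All (ℕ._≤ n) boxHeights
    heights-≤ = AllP.map⁺ (All.tabulate (λ {b} b∈ → height-≤ b (∈-boxPoints⁻ b b∈)))

  ℓ¹-normal : Fin (suc n) → ℤ
  ℓ¹-normal i = ℤΣ.sum (λ c → + ℤ.∣ inverse i (suc c) ∣)

  facet-≥-box : ∀ ε y → (∀ c → ℚ.- ε ℚ.≤ lookup y c × lookup y c ℚ.≤ ε) →
                ∀ i → ℤtoℚ (inverse i zero) ℚ.- ε ℚ.* ℤtoℚ (ℓ¹-normal i) ℚ.≤ (Aℚ ⊙ℚ homogenize 1ℚ y) i
  facet-≥-box ε y y∈box i = begin
    ℤtoℚ (a zero) ℚ.- ε ℚ.* ℤtoℚ (ℓ¹-normal i)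
      ≡⟨ cong₂ ℚ._+_ (ℚP.*-identityˡ (ℤtoℚ (a zero))) (cong (λ s → ℚ.- (ε ℚ.* s)) (sym (ℤtoℚ-sum (λ c → + ℤ.∣ a (suc c) ∣)))) ⟨
    1ℚ ℚ.* ℤtoℚ (a zero) ℚ.- ε ℚ.* ℚΣ.sum ∣a∣
      ≡⟨ cong (λ s → 1ℚ ℚ.* ℤtoℚ (a zero) ℚ.- s) (ℚΣ.*-distribˡ-sum ε ∣a∣) ⟩
    1ℚ ℚ.* ℤtoℚ (a zero) ℚ.- ℚΣ.sum (λ c → ε ℚ.* ∣a∣ c)
      ≡⟨ cong (1ℚ ℚ.* ℤtoℚ (a zero) ℚ.+_) (sumℚ-neg (λ c → ε ℚ.* ∣a∣ c)) ⟨
    1ℚ ℚ.* ℤtoℚ (a zero) ℚ.+ ℚΣ.sum (λ c → ℚ.- (ε ℚ.* ∣a∣ c))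
      ≤⟨ ℚP.+-monoʳ-≤ (1ℚ ℚ.* ℤtoℚ (a zero)) (sumℚ-mono-≤ (λ c → -ε∣a∣≤y*a (a (suc c)) (proj₁ (y∈box c)) (proj₂ (y∈box c)))) ⟩
    (Aℚ ⊙ℚ homogenize 1ℚ y) i ∎
    where
    open ℚP.≤-Reasoning
    a : Fin (suc n) → ℤ
    a = inverse i
    ∣a∣ : Fin n → ℚ
    ∣a∣ c = ℤtoℚ (+ ℤ.∣ a (suc c) ∣)

  OriginSlack : ℚ → Set
  OriginSlack ε = ∀ i → ε ℚ.* ℤtoℚ (ℓ¹-normal i) ℚ.≤ ℤtoℚ (inverse i zero)

  originSlack? : ∀ ε → Dec (OriginSlack ε)
  originSlack? ε = FinP.all? (λ i → ε ℚ.* ℤtoℚ (ℓ¹-normal i) ℚP.≤? ℤtoℚ (inverse i zero))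

  originInterior : ∀ ε → 0ℚ ℚ.< ε → OriginSlack ε → OriginInterior (simplex vs)
  originInterior ε ε>0 slack = ε , ε>0 , λ y y∈box → inverse-nonNeg⇒InDilate 1ℚ y λ i → begin
    0ℚ                                                      ≡⟨ ℚP.+-inverseʳ (ε ℚ.* ℤtoℚ (ℓ¹-normal i)) ⟨
    ε ℚ.* ℤtoℚ (ℓ¹-normal i) ℚ.- ε ℚ.* ℤtoℚ (ℓ¹-normal i)  ≤⟨ ℚP.+-monoˡ-≤ (ℚ.- (ε ℚ.* ℤtoℚ (ℓ¹-normal i))) (slack i) ⟩
    ℤtoℚ (inverse i zero) ℚ.- ε ℚ.* ℤtoℚ (ℓ¹-normal i)      ≤⟨ facet-≥-box ε y y∈box i ⟩
    (Aℚ ⊙ℚ homogenize 1ℚ y) i                               ∎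
    where open ℚP.≤-Reasoning

FacetRows : ∀ {n} → (Fin (suc n) → Vec ℤ n) → Matrix (suc n) (suc n) → (Fin (suc n) → ℕ) → Set
FacetRows vs A κ = (∀ i → ℕ.NonZero (κ i)) × (∀ i j → A i j ≡ + κ i ℤ.* homogenize (+ 1) (vs i) j)

facetRows? : ∀ {n} vs A κ → Dec (FacetRows {n} vs A κ)
facetRows? vs A κ = FinP.all? (ℕP.nonZero? ∘ κ) ×-dec
  FinP.all? (λ i → FinP.all? (λ j → A i j ℤ.≟ + κ i ℤ.* homogenize (+ 1) (vs i) j))

-- If the facet normals of the simplex Q are the vertices of P, then Q is the polar dual of P.
polarSimplex : ∀ {n} (vs us : Fin (suc n) → Vec ℤ n) (invQ : ScaledInverse (homogeneousVertices us)) κ →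
               FacetRows vs (ScaledInverse.inverse invQ) κ → PolarIsLattice (simplex vs)
polarSimplex {n} vs us invQ κ (κ≢0 , rows) = simplex us , λ y →
  (λ y∈P* → Q.inverse-nonNeg⇒InDilate 1ℚ y λ i → subst (0ℚ ℚ.≤_) (sym (facet y i))
     (*-nonNeg (ℕtoℚ-nonNeg (κ i)) (subst (ℚ._≤ 1ℚ ℚ.+ dotℚ (vs i) y) (ℚP.+-inverseʳ 1ℚ) (ℚP.+-monoʳ-≤ 1ℚ (y∈P* i))))) ,
  (λ y∈Q i → from-facet (dotℚ (vs i) y) (ℚP.*-cancelˡ-≤-pos (ℤtoℚ (+ κ i)) {{ℤtoℚ-positive (κ i) {{κ≢0 i}}}}
     (subst₂ ℚ._≤_ (sym (ℚP.*-zeroʳ (ℤtoℚ (+ κ i)))) (facet y i) (Q.InDilate⇒inverse-nonNeg 1ℚ y y∈Q i))))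
  where
  module Q = LatticeSimplex us invQ
  facet : ∀ y i → (Q.Aℚ ℚMatrix.⊙ homogenize 1ℚ y) i ≡ ℤtoℚ (+ κ i) ℚ.* (1ℚ ℚ.+ dotℚ (vs i) y)
  facet y i = begin
    1ℚ ℚ.* ℤtoℚ (AQ i zero) ℚ.+ ℚΣ.sum (λ c → lookup y c ℚ.* ℤtoℚ (AQ i (suc c)))
      ≡⟨ cong₂ ℚ._+_ (trans (ℚP.*-identityˡ _) (cong ℤtoℚ (trans (rows i zero) (ℤP.*-identityʳ (+ κ i)))))
                     (ℚΣ.sum-cong-≗ entry) ⟩
    κᵢ ℚ.+ ℚΣ.sum (λ c → κᵢ ℚ.* (v c ℚ.* lookup y c))
      ≡⟨ cong (κᵢ ℚ.+_) (ℚΣ.*-distribˡ-sum κᵢ (λ c → v c ℚ.* lookup y c)) ⟨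
    κᵢ ℚ.+ κᵢ ℚ.* ℚΣ.sum (λ c → v c ℚ.* lookup y c)
      ≡⟨ cong (λ s → κᵢ ℚ.+ κᵢ ℚ.* s) (sumℚ≡sum (λ c → v c ℚ.* lookup y c)) ⟨
    κᵢ ℚ.+ κᵢ ℚ.* dotℚ (vs i) y
      ≡⟨ solve 2 (λ k d → k :+ k :* d := k :* (con 1ℚ :+ d)) refl κᵢ (dotℚ (vs i) y) ⟩
    κᵢ ℚ.* (1ℚ ℚ.+ dotℚ (vs i) y) ∎
    where
    open ≡-Reasoning
    AQ : Matrix (suc n) (suc n)
    AQ = ScaledInverse.inverse invQ
    κᵢ : ℚ
    κᵢ = ℤtoℚ (+ κ i)
    v : Fin n → ℚ
    v c = ℤtoℚ (lookup (vs i) c)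
    entry : ∀ c → lookup y c ℚ.* ℤtoℚ (AQ i (suc c)) ≡ κᵢ ℚ.* (v c ℚ.* lookup y c)
    entry c = begin
      lookup y c ℚ.* ℤtoℚ (AQ i (suc c))               ≡⟨ cong (λ a → lookup y c ℚ.* ℤtoℚ a) (rows i (suc c)) ⟩
      lookup y c ℚ.* ℤtoℚ (+ κ i ℤ.* lookup (vs i) c)  ≡⟨ cong (lookup y c ℚ.*_) (ℤtoℚ-* (+ κ i) (lookup (vs i) c)) ⟩
      lookup y c ℚ.* (κᵢ ℚ.* v c)                      ≡⟨ solve 3 (λ y k v → y :* (k :* v) := k :* (v :* y)) refl (lookup y c) κᵢ (v c) ⟩
      κᵢ ℚ.* (v c ℚ.* lookup y c)                      ∎
  from-facet : ∀ d → 0ℚ ℚ.≤ 1ℚ ℚ.+ d → ℚ.- 1ℚ ℚ.≤ d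
  from-facet d 0≤1+d = subst₂ ℚ._≤_ (ℚP.+-identityʳ (ℚ.- 1ℚ)) (solve 1 (λ d → (:- con 1ℚ) :+ (con 1ℚ :+ d) := d) refl d)
                              (ℚP.+-monoʳ-≤ (ℚ.- 1ℚ) 0≤1+d)

coeff-beyond : ∀ p {j} → length p ℕ.≤ j → coeff p j ≡ + 0
coeff-beyond []                     _           = refl
coeff-beyond (a ∷ p) {suc j} (ℕ.s≤s length≤j) = coeff-beyond p length≤j

Degree-length : ∀ p {s} → length p ≡ suc s → coeff p s ≢ + 0 → Degree p s
Degree-length p length≡ leading≢0 = leading≢0 , λ j s<j → coeff-beyond p (subst (ℕ._≤ j) (sym length≡) s<j)

Degree-unique : ∀ p {s t} → Degree p s → Degree p t → s ≡ t
Degree-unique p {s} {t} (leading-s , beyond-s) (leading-t , beyond-t) with ℕP.<-cmp s t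
... | tri< s<t _ _ = contradiction (beyond-s t s<t) leading-t
... | tri≈ _ s≡t _ = s≡t
... | tri> _ _ t<s = contradiction (beyond-t s t<s) leading-s

-- For s = 2 the γ-expansion reads h₀ = γ₀ and h₁ = 2 γ₀ + γ₁.
γ₁-of-quadratic : ∀ p (γ : ℕ → ℤ) → (∀ i → coeff p i ≡ sumℤ 1 (λ j → γ j ℤ.* + shiftBinom (2 ℕ.∸ 2 ℕ.* j) j i)) →
                  γ 1 ≡ coeff p 1 ℤ.- + 2 ℤ.* coeff p 0
γ₁-of-quadratic p γ expansion = trans
  (ZS.solve 2 (λ a b → b ZS.:= (a ZS.:* ZS.con (+ 2) ZS.:+ b ZS.:* ZS.con (+ 1))
                                 ZS.:- ZS.con (+ 2) ZS.:* (a ZS.:* ZS.con (+ 1) ZS.:+ b ZS.:* ZS.con (+ 0))) refl (γ 0) (γ 1))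
  (cong₂ (λ h₁ h₀ → h₁ ℤ.- + 2 ℤ.* h₀) (sym (expansion 1)) (sym (expansion 0)))

module Examples where

  import Data.Integer.Literals as ℤLiterals
  import Data.Nat.Literals as ℕLiterals
  open import Agda.Builtin.FromNat using (Number; fromNat)
  open import Agda.Builtin.FromNeg using (Negative; fromNeg)
  open import Data.Unit using (tt)

  instance
    ℕ-number : Number ℕ
    ℕ-number = ℕLiterals.number
    ℤ-number : Number ℤ
    ℤ-number = ℤLiterals.number
    ℤ-negative : Negative ℤ
    ℤ-negative = ℤLiterals.negative

  fromRows : ∀ {m n} → Vec (Vec ℤ n) m → Matrix m n
  fromRows rows i j = lookup (lookup rows i) j

  module Triangle where

    vertices : Fin 3 → Vec ℤ 2
    vertices = lookup ((-1 ∷ -1 ∷ []) ∷ (1 ∷ 0 ∷ []) ∷ (0 ∷ 1 ∷ []) ∷ [])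

    P : LatticePolytope 2
    P = simplex vertices

    barycentric : Matrix 3 3
    barycentric = fromRows ((1 ∷ -1 ∷ -1 ∷ []) ∷ (1 ∷ 2 ∷ -1 ∷ []) ∷ (1 ∷ -1 ∷ 2 ∷ []) ∷ [])

    h : List ℤ
    h = 1 ∷ 1 ∷ 1 ∷ []

    module Δ = LatticeSimplex vertices (scaledInverse barycentric 3)

    heights : Δ.boxHeights ≡ 0 ∷ 1 ∷ 2 ∷ []
    heights = refl

    hStar-P : HStar P h
    hStar-P = Δ.hStar h refl coefficients
      where
      coefficients : ∀ j → coeff h j ≡ multiplicity j Δ.boxHeights
      coefficients j rewrite heights with j
      ... | 0 = refl
      ... | 1 = refl
      ... | 2 = refl
      ... | suc (suc (suc _)) = refl

    origin : Vec ℤ 2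
    origin = 0 ∷ 0 ∷ []

    -- The unit translate has the same vertices only propositionally, so it gets its own certificates.
    translate : Fin 3 → Vec ℤ 2
    translate = verts (dilTrans 1 origin P)

    module Δ′ = LatticeSimplex translate (scaledInverse barycentric 3)

    dualVertices : Fin 3 → Vec ℤ 2
    dualVertices = lookup ((-1 ∷ -1 ∷ []) ∷ (2 ∷ -1 ∷ []) ∷ (-1 ∷ 2 ∷ []) ∷ [])

    dualBarycentric : Matrix 3 3
    dualBarycentric = fromRows ((1 ∷ -1 ∷ -1 ∷ []) ∷ (1 ∷ 1 ∷ 0 ∷ []) ∷ (1 ∷ 0 ∷ 1 ∷ []) ∷ [])

    gorenstein-P : Gorenstein P
    gorenstein-P = 1 , ℕ.s≤s ℕ.z≤n , origin ,
      Δ′.originInterior ε (from-yes (0ℚ ℚ.<? ε)) (from-yes (Δ′.originSlack? ε)) ,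
      polarSimplex translate dualVertices (scaledInverse dualBarycentric 3) κ
                   (from-yes (facetRows? translate dualBarycentric κ))
      where
      ε : ℚ
      ε = + 1 ℚ./ 4
      κ : Fin 3 → ℕ
      κ _ = 1

    degree-h : Degree h 2
    degree-h = Degree-length h refl (λ ())

    logConcave-h : LogConcave h
    logConcave-h = 2 , degree-h , positive , concave
      where
      positive : ∀ j → j ℕ.≤ 2 → + 0 ℤ.< coeff h j
      positive 0 _ = ℤ.+<+ (ℕ.s≤s ℕ.z≤n)
      positive 1 _ = ℤ.+<+ (ℕ.s≤s ℕ.z≤n)
      positive 2 _ = ℤ.+<+ (ℕ.s≤s ℕ.z≤n)
      positive (suc (suc (suc _))) (ℕ.s≤s (ℕ.s≤s ()))
      concave : ∀ j → 1 ℕ.≤ j → suc j ℕ.≤ 2 → coeff h (j ℕ.∸ 1) ℤ.* coeff h (suc j) ℤ.≤ coeff h j ℤ.* coeff h j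
      concave 1 _ _ = ℤP.≤-refl
      concave (suc (suc _)) _ (ℕ.s≤s (ℕ.s≤s ()))

    not-γPositive-h : ¬ GammaPositive h
    not-γPositive-h (s , degree , _ , γ , γ≥0 , expansion) with Degree-unique h degree degree-h
    ... | refl = contradiction (γ≥0 1 (ℕ.s≤s ℕ.z≤n)) (subst (λ g → ¬ (+ 0 ℤ.≤ g)) (sym γ₁≡-1) λ ())
      where
      γ₁≡-1 : γ 1 ≡ -1
      γ₁≡-1 = γ₁-of-quadratic h γ expansion

  module FourSimplex where

    vertices : Fin 5 → Vec ℤ 4
    vertices = lookup ((-1 ∷ -2 ∷  0 ∷  0 ∷ []) ∷
                       ( 0 ∷  1 ∷ -2 ∷ -1 ∷ []) ∷
                       ( 1 ∷  0 ∷  0 ∷ -1 ∷ []) ∷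
                       ( 0 ∷  1 ∷  2 ∷  1 ∷ []) ∷
                       ( 1 ∷  0 ∷  0 ∷  1 ∷ []) ∷ [])

    P : LatticePolytope 4
    P = simplex vertices

    barycentric : Matrix 5 5
    barycentric = fromRows ((2 ∷ -2 ∷ -2 ∷  0 ∷  0 ∷ []) ∷
                            (2 ∷ -2 ∷  2 ∷ -2 ∷  0 ∷ []) ∷
                            (1 ∷  3 ∷ -1 ∷  2 ∷ -4 ∷ []) ∷
                            (2 ∷ -2 ∷  2 ∷  2 ∷  0 ∷ []) ∷
                            (1 ∷  3 ∷ -1 ∷ -2 ∷  4 ∷ []) ∷ [])

    h : List ℤ
    h = 1 ∷ 4 ∷ 22 ∷ 4 ∷ 1 ∷ []

    module Δ = LatticeSimplex vertices (scaledInverse barycentric 8)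

    heights : Δ.boxHeights ≡ 0 ∷ List.replicate 4 1 List.++ List.replicate 22 2 List.++ List.replicate 4 3 List.++ 4 ∷ []
    heights = refl

    hStar-P : HStar P h
    hStar-P = Δ.hStar h refl coefficients
      where
      coefficients : ∀ j → coeff h j ≡ multiplicity j Δ.boxHeights
      coefficients j rewrite heights with j
      ... | 0 = refl
      ... | 1 = refl
      ... | 2 = refl
      ... | 3 = refl
      ... | 4 = refl
      ... | suc (suc (suc (suc (suc _)))) = refl

    origin : Vec ℤ 4
    origin = 0 ∷ 0 ∷ 0 ∷ 0 ∷ []

    translate : Fin 5 → Vec ℤ 4
    translate = verts (dilTrans 1 origin P)

    module Δ′ = LatticeSimplex translate (scaledInverse barycentric 8)

    dualVertices : Fin 5 → Vec ℤ 4
    dualVertices = lookup ((-1 ∷ -1 ∷  0 ∷  0 ∷ []) ∷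
                           (-1 ∷  1 ∷ -1 ∷  0 ∷ []) ∷
                           ( 3 ∷ -1 ∷  2 ∷ -4 ∷ []) ∷
                           (-1 ∷  1 ∷  1 ∷  0 ∷ []) ∷
                           ( 3 ∷ -1 ∷ -2 ∷  4 ∷ []) ∷ [])

    dualBarycentric : Matrix 5 5
    dualBarycentric = fromRows ((2 ∷ -2 ∷ -4 ∷  0 ∷  0 ∷ []) ∷
                                (2 ∷  0 ∷  2 ∷ -4 ∷ -2 ∷ []) ∷
                                (1 ∷  1 ∷  0 ∷  0 ∷ -1 ∷ []) ∷
                                (2 ∷  0 ∷  2 ∷  4 ∷  2 ∷ []) ∷
                                (1 ∷  1 ∷  0 ∷  0 ∷  1 ∷ []) ∷ [])

    gorenstein-P : Gorenstein P
    gorenstein-P = 1 , ℕ.s≤s ℕ.z≤n , origin ,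
      Δ′.originInterior ε (from-yes (0ℚ ℚ.<? ε)) (from-yes (Δ′.originSlack? ε)) ,
      polarSimplex translate dualVertices (scaledInverse dualBarycentric 8) κ
                   (from-yes (facetRows? translate dualBarycentric κ))
      where
      ε : ℚ
      ε = + 1 ℚ./ 16
      κ : Fin 5 → ℕ
      κ = lookup (2 ∷ 2 ∷ 1 ∷ 2 ∷ 1 ∷ [])

    degree-h : Degree h 4
    degree-h = Degree-length h refl (λ ())

    γPositive-h : GammaPositive h
    γPositive-h = 4 , degree-h , palindromic , γ , γ≥0 , expansion
      where
      γ : ℕ → ℤ
      γ 0 = 1
      γ 2 = 16
      γ _ = 0
      palindromic : Palindromic h 4
      palindromic 0 _ = refl
      palindromic 1 _ = refl
      palindromic 2 _ = refl
      palindromic 3 _ = refl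
      palindromic 4 _ = refl
      palindromic (suc (suc (suc (suc (suc _))))) (ℕ.s≤s (ℕ.s≤s (ℕ.s≤s (ℕ.s≤s ()))))
      γ≥0 : ∀ j → j ℕ.≤ 2 → + 0 ℤ.≤ γ j
      γ≥0 0 _ = ℤ.+≤+ ℕ.z≤n
      γ≥0 1 _ = ℤ.+≤+ ℕ.z≤n
      γ≥0 2 _ = ℤ.+≤+ ℕ.z≤n
      γ≥0 (suc (suc (suc _))) (ℕ.s≤s (ℕ.s≤s ()))
      expansion : ∀ i → coeff h i ≡ sumℤ 2 (λ j → γ j ℤ.* + shiftBinom (4 ℕ.∸ 2 ℕ.* j) j i)
      expansion 0 = refl
      expansion 1 = refl
      expansion 2 = refl
      expansion 3 = refl
      expansion 4 = refl
      expansion (suc (suc (suc (suc (suc _))))) = refl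

    not-logConcave-h : ¬ LogConcave h
    not-logConcave-h (s , degree , _ , concave) with Degree-unique h degree degree-h
    ... | refl = from-no (22 ℤ.≤? 16) (concave 1 (ℕ.s≤s ℕ.z≤n) (ℕ.s≤s (ℕ.s≤s ℕ.z≤n)))

mainTheorem19 :
    (Σ ℕ λ n → Σ (LatticePolytope n) λ P → Σ (List ℤ) λ h →
       Gorenstein P × HStar P h × GammaPositive h × ¬ LogConcave h)
    ×
    (Σ ℕ λ n → Σ (LatticePolytope n) λ P → Σ (List ℤ) λ h →
       Gorenstein P × HStar P h × LogConcave h × ¬ GammaPositive h)
mainTheorem19 =
  (4 , S.P , S.h , S.gorenstein-P , S.hStar-P , S.γPositive-h , S.not-logConcave-h) ,
  (2 , T.P , T.h , T.gorenstein-P , T.hStar-P , T.logConcave-h , T.not-γPositive-h)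
  where
  module S = Examples.FourSimplex
  module T = Examples.Triangle
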